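{- Let $\mathcal{S}$ be a signature. The image $\mathsf{r}_{\mathbb{A}_{\mathbb{N}}}(\mathbf{N}(\mathfrak{T}(\mathcal{S})))$ is a Hopf subalgebra of the polynomial realization of $\mathbf{WQSym}$ (the span of the polynomials $\mathsf{M}_u$). More precisely, for every reduced $\mathcal{S}$-forest $\mathfrak{f}$, \[ \mathsf{r}_{\mathbb{A}_{\mathbb{N}}}(\mathsf{E}_{\mathfrak{f}})=\sum_{u\in\mathcal{P}}[u\vdash\mathfrak{f}]\,\mathsf{M}_u . \]
   Context: A signature is a graded set $\mathcal{S}=\bigsqcup_{n\ge0}\mathcal{S}(n)$; $\mathcal{S}$-terms are planar rooted trees with internal nodes decorated by $\mathcal{S}$ (a node decorated by $\mathsf{g}\in\mathcal{S}(n)$ has $n$ ordered children), or the single leaf $\perp$; a reduced $\mathcal{S}$-forest is a word of $\mathcal{S}$-terms none equal to $\perp$, with internal nodes numbered $1,\dots,\mathrm{dg}(\mathfrak{f})$ (number of internal nodes) in left-to-right preorder. The natural Hopf algebra $\mathbf{N}(\mathfrak{T}(\mathcal{S}))$ over a field $\mathbb{K}$ of characteristic $0$ has basis $\mathsf{E}_{\mathfrak{f}}$ indexed by reduced $\mathcal{S}$-forests, product concatenation, and coproduct the algebra morphism with $\Delta\mathsf{E}_{\mathfrak{t}}=\sum\mathsf{E}_{\mathrm{rd}(\mathfrak{s})}\otimes\mathsf{E}_{\mathrm{rd}(\mathfrak{u}_1\cdots\mathfrak{u}_n)}$ over all ways of writing $\mathfrak{t}$ as $\mathfrak{s}$ with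 the roots of terms $\mathfrak{u}_1,\dots,\mathfrak{u}_n$ grafted on its $n$ leaves ($\mathrm{rd}$ deletes letters $\perp$). Let $\mathbb{A}_{\mathbb{N}}=\{\mathbf{a}_i:i\in\mathbb{N}\}$. For a reduced forest $\mathfrak{f}$, $\mathsf{r}_{\mathbb{A}_{\mathbb{N}}}(\mathsf{E}_{\mathfrak{f}})$ is the sum of all words $\mathbf{a}_{i_1}\cdots\mathbf{a}_{i_d}$ with $d=\mathrm{dg}(\mathfrak{f})$ such that $i_k<i_{k'}$ whenever node $k'$ is a child of node $k$ in $\mathfrak{f}$; $\mathsf{r}_{\mathbb{A}_{\mathbb{N}}}$ is extended linearly (values in noncommutative polynomials of finite degree, possibly infinite support). The packing $\mathrm{pck}(w)$ of a word $w$ on a totally ordered alphabet replaces each letter $a$ by the number of distinct letters $\le a$ in $w$; a word $u$ of positive integers is packed if $\mathrm{pck}(u)=u$; $\mathcal{P}$ is the set of packed words. For $u\in\mathcal{P}$, $\mathsf{M}_u:=\sum_{w}[\mathrm{pck}(w)=u]\,w$ over words $w$ on $\mathbb{A}_{\mathbb{N}}$ ordered by $\mathbf{a}_i\le\mathbf{a}_{i'}$ iff $i\le i'$. The span of the $\mathsf{M}_u$ is the polynomial realization of $\mathbf{WQSym}$: product is the product of polynomials, and coproduct $\Delta\mathsf{M}_u=\sum_{k=0}^{\max(u)}\mathsf{M}_{u_{|\le k}}\otimes\mathsf{M}_{\mathrm{pck}(u_{|>k})}$, where $u_{|\le k}$ (resp. $u_{|>k}$) is the subword of letters $\le k$ (resp.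 $>k$), and $\mathsf{M}_\epsilon=1$. A packed word $u$ is $\mathfrak{f}$-compatible, written $u\vdash\mathfrak{f}$, if $\ell(u)=\mathrm{dg}(\mathfrak{f})$ and $u_k<u_{k'}$ whenever node $k'$ is a child of node $k$ in $\mathfrak{f}$. -}

module Defs where

open import Level using (Level; _⊔_) renaming (suc to lsuc)
open import Algebra.Bundles using (CommutativeRing)
open import Data.Nat as ℕ using (ℕ; zero; suc; _<_; _≤?_; _<?_)
open import Data.Nat.Properties using () renaming (_≟_ to _≟ℕ_)
open import Data.List using (List; []; _∷_; _++_; map; filter; deduplicate; length; foldr; upTo; concatMap; take; drop)
open import Data.List.Properties using (≡-dec)
open import Data.List.Relation.Unary.All using (All; all?)
open import Data.Vec using (Vec; []; _∷_)
open import Data.Maybe using (Maybe; just; nothing)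
open import Data.Product using (Σ; ∃; _×_; _,_; proj₁; proj₂)
open import Data.Empty using (⊥)
open import Relation.Nullary using (¬_; Dec; yes; no; does)
open import Relation.Nullary.Decidable using (_×-dec_)
open import Relation.Binary.PropositionalEquality using (_≡_)
open import Data.Bool using (if_then_else_)

natK : ∀ {c ℓ} (R : CommutativeRing c ℓ) → ℕ → CommutativeRing.Carrier R
natK R zero = CommutativeRing.0# R
natK R (suc n) = CommutativeRing._+_ R (CommutativeRing.1# R) (natK R n)

record Char0Field (c ℓ : Level) : Set (lsuc (c ⊔ ℓ)) where
  field
    commRing : CommutativeRing c ℓ
  open CommutativeRing commRing public
  field
    nontrivial : ¬ (1# ≈ 0#)
    inverse    : ∀ x → ¬ (x ≈ 0#) → ∃ λ y → (x * y) ≈ 1#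
    char0      : ∀ n → natK commRing n ≈ 0# → n ≡ 0

record Signature : Set₁ where
  field
    Op : Set          -- the graded set S = ⊔ S(n)
    ar : Op → ℕ       -- g ∈ S(ar g)
open Signature public

module _ (S : Signature) where
  data Term : Set where
    ⊥t   : Term
    node : (g : Op S) → Vec Term (ar S g) → Term

-- a term different from ⊥ : a root decoration together with its children
NTerm : Signature → Set
NTerm S = Σ (Op S) (λ g → Vec (Term S) (ar S g))

-- reduced S-forest: word of S-terms none equal to ⊥
Forest : Signature → Set
Forest S = List (NTerm S)

module _ {S : Signature} where
  mutual
    size : Term S → ℕ
    size ⊥t = 0
    size (node g ts) = suc (sizes ts)

    sizes : ∀ {n} → Vec (Term S) n → ℕ
    sizes [] = 0
    sizes (t ∷ ts) = size t ℕ.+ sizes ts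

  dg : Forest S → ℕ
  dg [] = 0
  dg ((g , ts) ∷ f) = suc (sizes ts) ℕ.+ dg f

  -- childEdges p q ts : parent–child pairs (0-based preorder positions),
  -- where ts are the children of the node at position p and the first
  -- internal node among ts has position q.
  childEdges : ∀ {n} → ℕ → ℕ → Vec (Term S) n → List (ℕ × ℕ)
  childEdges p q [] = []
  childEdges p q (⊥t ∷ ts) = childEdges p q ts
  childEdges p q (node g us ∷ ts) =
    ((p , q) ∷ childEdges q (suc q) us) ++ childEdges p (q ℕ.+ suc (sizes us)) ts

  -- all pairs (k , k') such that node k' is a child of node k
  -- (nodes numbered 0,…,dg f − 1 in left-to-right preorder)
  forestEdges′ : ℕ → Forest S → List (ℕ × ℕ)
  forestEdges′ o [] = []
  forestEdges′ o ((g , ts) ∷ f) =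
    childEdges o (suc o) ts ++ forestEdges′ (o ℕ.+ suc (sizes ts)) f

  forestEdges : Forest S → List (ℕ × ℕ)
  forestEdges = forestEdges′ 0

-- Words on A_ℕ: the letter a_i is represented by i

Word : Set
Word = List ℕ

nth : Word → ℕ → Maybe ℕ
nth [] k = nothing
nth (x ∷ w) zero = just x
nth (x ∷ w) (suc k) = nth w k

ltM : Maybe ℕ → Maybe ℕ → Set
ltM (just a) (just b) = a < b
ltM _ _ = ⊥

ltM? : ∀ x y → Dec (ltM x y)
ltM? (just a) (just b) = a <? b
ltM? (just a) nothing = no λ ()
ltM? nothing y = no λ ()

-- w is f-compatible: ℓ(w) = dg f and w_k < w_k' whenever k' is a child of k.
-- (Used both for packed words, u ⊢ f, and for the words in r(E_f).)
Compat : {S : Signature} → Forest S → Word → Set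
Compat f w = length w ≡ dg f × All (λ e → ltM (nth w (proj₁ e)) (nth w (proj₂ e))) (forestEdges f)

Compat? : {S : Signature} (f : Forest S) (w : Word) → Dec (Compat f w)
Compat? f w = (length w ≟ℕ dg f) ×-dec all? (λ e → ltM? (nth w (proj₁ e)) (nth w (proj₂ e))) (forestEdges f)

pck : Word → Word
pck w = map (λ a → length (deduplicate _≟ℕ_ (filter (_≤? a) w))) w

IsPacked : Word → Set
IsPacked u = pck u ≡ u

_≟W_ : (u v : Word) → Dec (u ≡ v)
_≟W_ = ≡-dec _≟ℕ_

wordsOver : ℕ → ℕ → List Word
wordsOver m zero = [] ∷ []
wordsOver m (suc d) = concatMap (λ a → map (a ∷_) (wordsOver m d)) (map suc (upTo m))

packedWords : ℕ → List Word
packedWords d = filter (λ u → pck u ≟W u) (wordsOver d d)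

maxW : Word → ℕ
maxW = foldr ℕ._⊔_ 0

-- Noncommutative polynomials over K in A_ℕ (finite degree, possibly
-- infinite support) as coefficient functions; tensor squares likewise.

module Poly {c ℓ : Level} (K : Char0Field c ℓ) where
  open Char0Field K

  Pol : Set c
  Pol = Word → Carrier

  Pol² : Set c
  Pol² = Word → Word → Carrier

  _≐_ : Pol → Pol → Set ℓ
  P ≐ Q = ∀ w → P w ≈ Q w

  _≐²_ : Pol² → Pol² → Set ℓ
  T ≐² T′ = ∀ w₁ w₂ → T w₁ w₂ ≈ T′ w₁ w₂

  Σ[_] : List Carrier → Carrier
  Σ[_] = foldr _+_ 0#

  [_]? : ∀ {p} {P : Set p} → Dec P → Carrier
  [ d ]? = if does d then 1# else 0#

  0P 1P : Pol
  0P w = 0#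
  1P [] = 1#
  1P (_ ∷ _) = 0#

  _+P_ : Pol → Pol → Pol
  (P +P Q) w = P w + Q w

  _·P_ : Carrier → Pol → Pol
  (a ·P P) w = a * P w

  _*P_ : Pol → Pol → Pol
  (P *P Q) w = Σ[ map (λ i → P (take i w) * Q (drop i w)) (upTo (suc (length w))) ]

  rE : {S : Signature} → Forest S → Pol
  rE f w = [ Compat? f w ]?

  rLin : {S : Signature} → List (Carrier × Forest S) → Pol
  rLin cs w = Σ[ map (λ cf → proj₁ cf * rE (proj₂ cf) w) cs ]

  M : Word → Pol
  M u w = [ pck w ≟W u ]?

  evalM : List (Carrier × Word) → Pol
  evalM L w = Σ[ map (λ cu → proj₁ cu * M (proj₂ cu) w) L ]

  ΔM : Word → Pol²
  ΔM u w₁ w₂ = Σ[ map (λ k → M (filter (_≤? k) u) w₁ * M (pck (filter (k <?_) u)) w₂)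
                      (upTo (suc (maxW u))) ]

  ΔL : List (Carrier × Word) → Pol²
  ΔL L w₁ w₂ = Σ[ map (λ cu → proj₁ cu * ΔM (proj₂ cu) w₁ w₂) L ]

  InWQSym : Pol → Set (c ⊔ ℓ)
  InWQSym P = ∃ λ (L : List (Carrier × Word)) → All (λ cu → IsPacked (proj₂ cu)) L × (P ≐ evalM L)

  InTensor : ∀ {p} → (Pol → Set p) → Pol² → Set (c ⊔ ℓ ⊔ p)
  InTensor V T = ∃ λ (L : List (Carrier × Pol × Pol)) →
    All (λ x → V (proj₁ (proj₂ x)) × V (proj₂ (proj₂ x))) L ×
    (T ≐² (λ w₁ w₂ → Σ[ map (λ x → proj₁ x * (proj₁ (proj₂ x) w₁ * proj₂ (proj₂ x) w₂)) L ]))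

  record IsHopfSubalgebraOfWQSym {p} (V : Pol → Set p) : Set (c ⊔ ℓ ⊔ p) where
    field
      sub     : ∀ P → V P → InWQSym P
      resp    : ∀ P Q → P ≐ Q → V P → V Q
      zero∈   : V 0P
      +-closed : ∀ P Q → V P → V Q → V (P +P Q)
      ·-closed : ∀ a P → V P → V (a ·P P)
      one∈    : V 1P
      *-closed : ∀ P Q → V P → V Q → V (P *P Q)
      Δ-closed : ∀ P (L : List (Carrier × Word)) → V P →
                 All (λ cu → IsPacked (proj₂ cu)) L → P ≐ evalM L → InTensor V (ΔL L)

  InImage : (S : Signature) → Pol → Set (c ⊔ ℓ)
  InImage S P = ∃ λ (cs : List (Carrier × Forest S)) → P ≐ rLin cs

{-# OPTIONS --safe #-}
-- A word is f-compatible iff its packing is, so r(E_f) is the sum of the M_u over the packed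
-- u ⊢ f. A word is compatible with a concatenation f g iff its prefix of length dg f is
-- f-compatible and the rest g-compatible, so r is multiplicative. For the coproduct, ΔM_u
-- evaluated at (w₁, w₂) counts the ways of reading u as a shuffle of pck w₁ with pck w₂
-- shifted above max (pck w₁); hence ΔP (w₁, w₂) is the sum of P over these shuffles. For
-- P = r(E_f), an increasing labelling of f by such a shuffle is an admissible cut of f (the
-- nodes labelled from w₂ are closed under taking descendants) together with increasing
-- labellings of the trunk by w₁ and of the pruned forest by w₂, as in the coproduct of E_f.
module Submission where

open import Level using (Level)
open import Data.Product using (_×_; _,_)
open import Data.List using (map)
open import Defs

module FilterDedup where

  open import Data.Nat using (ℕ; suc; _≤_; _<_; z≤n; s≤s)
  open import Data.Nat.Properties using (_≟_; ≤-refl; m≤n⇒m≤1+n)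
  open import Data.List using (List; []; _∷_; map; filter; deduplicate; length)
  open import Data.List.Properties using (filter-accept; filter-reject; filter-all)
  open import Data.List.Membership.Propositional using (_∈_)
  open import Data.List.Membership.Propositional.Properties using (∈-deduplicate⁻)
  open import Data.List.Relation.Unary.Any using (here; there)
  open import Data.List.Relation.Unary.All using (All; []; _∷_)
  open import Data.List.Relation.Unary.All.Properties using (All¬⇒¬Any)
  open import Data.List.Relation.Unary.AllPairs using (_∷_)
  open import Data.List.Relation.Unary.Unique.Propositional using (Unique)
  import Data.List.Relation.Unary.Unique.DecPropositional.Properties as UniqueDec
  open import Data.Empty using (⊥-elim)
  open import Relation.Nullary using (¬_; Dec; yes; no; ¬?)
  open import Relation.Unary using (Pred; Decidable)
  open import Relation.Binary.PropositionalEquality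
  open import Function using (_∘_; _⇔_; mk⇔; Equivalence)
  open import Level using (0ℓ)

  private variable
    A B : Set

  module _ {P Q : Pred A 0ℓ} (P? : Decidable P) (Q? : Decidable Q) where

    filter-comm : ∀ xs → filter P? (filter Q? xs) ≡ filter Q? (filter P? xs)
    filter-comm [] = refl
    filter-comm (x ∷ xs) with Q? x | P? x
    ... | yes q | yes p rewrite filter-accept Q? {x} {filter P? xs} q | filter-accept P? {x} {filter Q? xs} p
          = cong (x ∷_) (filter-comm xs)
    ... | yes q | no ¬p rewrite filter-reject P? {x} {filter Q? xs} ¬p = filter-comm xs
    ... | no ¬q | yes p rewrite filter-reject Q? {x} {filter P? xs} ¬q = filter-comm xs
    ... | no ¬q | no ¬p = filter-comm xs

    filter-filter-⊆ : (∀ {x} → P x → Q x) → ∀ xs → filter P? (filter Q? xs) ≡ filter P? xs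
    filter-filter-⊆ P⊆Q [] = refl
    filter-filter-⊆ P⊆Q (x ∷ xs) with Q? x | P? x
    ... | yes q | yes p rewrite filter-accept P? {x} {filter Q? xs} p = cong (x ∷_) (filter-filter-⊆ P⊆Q xs)
    ... | yes q | no ¬p rewrite filter-reject P? {x} {filter Q? xs} ¬p = filter-filter-⊆ P⊆Q xs
    ... | no ¬q | yes p = ⊥-elim (¬q (P⊆Q p))
    ... | no ¬q | no ¬p = filter-filter-⊆ P⊆Q xs

    filter-≐-local : ∀ xs → (∀ {x} → x ∈ xs → P x ⇔ Q x) → filter P? xs ≡ filter Q? xs
    filter-≐-local [] P⇔Q = refl
    filter-≐-local (x ∷ xs) P⇔Q with P? x | Q? x
    ... | yes p | yes q = cong (x ∷_) (filter-≐-local xs (P⇔Q ∘ there))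
    ... | yes p | no ¬q = ⊥-elim (¬q (Equivalence.to (P⇔Q (here refl)) p))
    ... | no ¬p | yes q = ⊥-elim (¬p (Equivalence.from (P⇔Q (here refl)) q))
    ... | no ¬p | no ¬q = filter-≐-local xs (P⇔Q ∘ there)

    length-filter-⊆ : (∀ {x} → P x → Q x) → ∀ xs → length (filter P? xs) ≤ length (filter Q? xs)
    length-filter-⊆ P⊆Q [] = z≤n
    length-filter-⊆ P⊆Q (x ∷ xs) with P? x | Q? x
    ... | yes p | yes q = s≤s (length-filter-⊆ P⊆Q xs)
    ... | yes p | no ¬q = ⊥-elim (¬q (P⊆Q p))
    ... | no ¬p | yes q = m≤n⇒m≤1+n (length-filter-⊆ P⊆Q xs)
    ... | no ¬p | no ¬q = length-filter-⊆ P⊆Q xs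

    length-filter-⊂ : (∀ {x} → P x → Q x) → ∀ xs y → y ∈ xs → Q y → ¬ P y →
                      length (filter P? xs) < length (filter Q? xs)
    length-filter-⊂ P⊆Q (x ∷ xs) y (here refl) qy ¬py with P? x | Q? x
    ... | yes p | _ = ⊥-elim (¬py p)
    ... | no _ | yes q = s≤s (length-filter-⊆ P⊆Q xs)
    ... | no _ | no ¬q = ⊥-elim (¬q qy)
    length-filter-⊂ P⊆Q (x ∷ xs) y (there y∈) qy ¬py with P? x | Q? x
    ... | yes p | yes q = s≤s (length-filter-⊂ P⊆Q xs y y∈ qy ¬py)
    ... | yes p | no ¬q = ⊥-elim (¬q (P⊆Q p))
    ... | no ¬p | yes q = m≤n⇒m≤1+n (length-filter-⊂ P⊆Q xs y y∈ qy ¬py)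
    ... | no ¬p | no ¬q = length-filter-⊂ P⊆Q xs y y∈ qy ¬py

  filter-map : {P : Pred B 0ℓ} (P? : Decidable P) (f : A → B) → ∀ xs → filter P? (map f xs) ≡ map f (filter (P? ∘ f) xs)
  filter-map P? f [] = refl
  filter-map P? f (x ∷ xs) with P? (f x)
  ... | yes p = cong (f x ∷_) (filter-map P? f xs)
  ... | no ¬p = filter-map P? f xs

  filter≡[]⇒none : {P : Pred A 0ℓ} (P? : Decidable P) → ∀ xs → filter P? xs ≡ [] → All (¬_ ∘ P) xs
  filter≡[]⇒none P? [] e = []
  filter≡[]⇒none P? (x ∷ xs) e with P? x
  ... | no ¬p = ¬p ∷ filter≡[]⇒none P? xs e

  dedup : List ℕ → List ℕ
  dedup = deduplicate _≟_

  ≢? : (x y : ℕ) → Dec (¬ x ≡ y)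
  ≢? x y = ¬? (x ≟ y)

  dedup-filter : {P : Pred ℕ 0ℓ} (P? : Decidable P) → ∀ xs → dedup (filter P? xs) ≡ filter P? (dedup xs)
  dedup-filter P? [] = refl
  dedup-filter P? (x ∷ xs) with P? x
  ... | yes p = cong (x ∷_) (trans (cong (filter (≢? x)) (dedup-filter P? xs))
                            (filter-comm (≢? x) P? (dedup xs)))
  ... | no ¬p = trans (dedup-filter P? xs)
                  (sym (filter-filter-⊆ P? (≢? x) (λ {y} py eq → ¬p (subst _ (sym eq) py)) (dedup xs)))

  dedup-map : (f : ℕ → ℕ) → ∀ xs → (∀ {x y} → x ∈ xs → y ∈ xs → f x ≡ f y → x ≡ y) →
              dedup (map f xs) ≡ map f (dedup xs)
  dedup-map f [] inj = refl
  dedup-map f (x ∷ xs) inj = cong (f x ∷_) (begin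
      filter (≢? (f x)) (dedup (map f xs))
        ≡⟨ cong (filter (≢? (f x))) (dedup-map f xs (λ a b → inj (there a) (there b))) ⟩
      filter (≢? (f x)) (map f (dedup xs))
        ≡⟨ filter-map (≢? (f x)) f (dedup xs) ⟩
      map f (filter (≢? (f x) ∘ f) (dedup xs))
        ≡⟨ cong (map f) (filter-≐-local (≢? (f x) ∘ f) (≢? x) (dedup xs)
             (λ y∈ → mk⇔ (λ h e → h (cong f e))
                         (λ h e → h (inj (here refl) (there (∈-deduplicate⁻ _≟_ xs y∈)) e)))) ⟩
      map f (filter (≢? x) (dedup xs)) ∎)
    where open ≡-Reasoning

  dedup-unique : ∀ xs → Unique (dedup xs)
  dedup-unique = UniqueDec.deduplicate-! _≟_

  length-remove-∈ : ∀ n xs → Unique xs → n ∈ xs → length xs ≡ suc (length (filter (≢? n) xs))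
  length-remove-∈ n (x ∷ xs) (x∉ ∷ u) (here refl)
    rewrite filter-reject (≢? n) {n} {xs} (λ h → h refl) | filter-all (≢? n) x∉ = refl
  length-remove-∈ n (x ∷ xs) (x∉ ∷ u) (there n∈) with n ≟ x
  ... | no ne rewrite filter-accept (≢? n) {x} {xs} ne = cong suc (length-remove-∈ n xs u n∈)
  ... | yes refl = ⊥-elim (All¬⇒¬Any x∉ n∈)

  length-remove-≤ : ∀ n xs → Unique xs → length xs ≤ suc (length (filter (≢? n) xs))
  length-remove-≤ n [] u = z≤n
  length-remove-≤ n (x ∷ xs) (x∉ ∷ u) with n ≟ x
  ... | no ne rewrite filter-accept (≢? n) {x} {xs} ne = s≤s (length-remove-≤ n xs u)
  ... | yes refl rewrite filter-reject (≢? n) {n} {xs} (λ h → h refl) | filter-all (≢? n) x∉ = ≤-refl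


module TakeDrop where

  open import Data.Nat using (zero; suc; _+_; _≤_; s≤s)
  open import Data.Nat.Properties using (suc-injective; m≤n⇒m⊓n≡m)
  open import Data.List using (List; []; _∷_; _++_; length; take; drop)
  open import Data.List.Properties using (length-++; take++drop≡id; length-take)
  open import Relation.Binary.PropositionalEquality

  private variable
    A : Set

  length-take+drop : ∀ n (xs : List A) → length xs ≡ length (take n xs) + length (drop n xs)
  length-take+drop n xs = trans (cong length (sym (take++drop≡id n xs))) (length-++ (take n xs))

  length-take≤ : ∀ n (xs : List A) → n ≤ length xs → length (take n xs) ≡ n
  length-take≤ n xs n≤ = trans (length-take n xs) (m≤n⇒m⊓n≡m n≤)

  drop-++ : ∀ n (xs ys : List A) → n ≤ length xs → drop n (xs ++ ys) ≡ drop n xs ++ ys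
  drop-++ zero xs ys _ = refl
  drop-++ (suc n) (x ∷ xs) ys (s≤s n≤) = drop-++ n xs ys n≤

  take-++-length : ∀ (xs ys : List A) n → n ≡ length xs → take n (xs ++ ys) ≡ xs
  take-++-length [] ys zero e = refl
  take-++-length (x ∷ xs) ys (suc n) e = cong (x ∷_) (take-++-length xs ys n (suc-injective e))

  drop-++-length : ∀ (xs ys : List A) n → n ≡ length xs → drop n (xs ++ ys) ≡ ys
  drop-++-length [] ys zero e = refl
  drop-++-length (x ∷ xs) ys (suc n) e = drop-++-length xs ys n (suc-injective e)


module BoolFacts where

  open import Data.Nat using (_≡ᵇ_)
  open import Data.Nat.Properties using (≡⇒≡ᵇ; ≡ᵇ⇒≡)
  open import Data.Bool using (Bool; true; false; _∧_; T)
  open import Data.Bool.Properties using (T-∧; ∧-commutativeMonoid)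
  open import Data.Unit using (tt)
  open import Data.Product using (_×_)
  open import Data.Empty using (⊥-elim)
  open import Relation.Nullary using (¬_; Dec; yes; no; does)
  open import Relation.Binary.PropositionalEquality using (_≡_; refl; trans; sym)
  open import Function using (_⇔_; Equivalence)
  open import Algebra.Solver.CommutativeMonoid ∧-commutativeMonoid using (solve; _⊕_; _⊜_)
  open import Defs using (Word; _≟W_)

  T-∧⁻ : ∀ {a b} → T (a ∧ b) → T a × T b
  T-∧⁻ = Equivalence.to T-∧

  T-∧⁺ : ∀ {a b} → T a → T b → T (a ∧ b)
  T-∧⁺ {true} ta tb = tb

  T⇒≡true : ∀ {b} → T b → b ≡ true
  T⇒≡true {true} _ = refl

  ¬T⇒≡false : ∀ {b} → ¬ T b → b ≡ false
  ¬T⇒≡false {true} ¬t = ⊥-elim (¬t tt)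
  ¬T⇒≡false {false} _ = refl

  T-ext : ∀ {b b′} → (T b → T b′) → (T b′ → T b) → b ≡ b′
  T-ext {true} {true} f g = refl
  T-ext {true} {false} f g = ⊥-elim (f tt)
  T-ext {false} {true} f g = ⊥-elim (g tt)
  T-ext {false} {false} f g = refl

  does-cong : ∀ {P Q : Set} (p : Dec P) (q : Dec Q) → (P → Q) → (Q → P) → does p ≡ does q
  does-cong (yes p) (yes q) f g = refl
  does-cong (yes p) (no ¬q) f g = ⊥-elim (¬q (f p))
  does-cong (no ¬p) (yes q) f g = ⊥-elim (¬p (g q))
  does-cong (no ¬p) (no ¬q) f g = refl

  does≡ : ∀ {P : Set} (d : Dec P) {b} → (P ⇔ T b) → does d ≡ b
  does≡ (yes p) {true} h = refl
  does≡ (yes p) {false} h = ⊥-elim (Equivalence.to h p)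
  does≡ (no ¬p) {true} h = ⊥-elim (¬p (Equivalence.from h tt))
  does≡ (no ¬p) {false} h = refl

  ≟W-sound : ∀ {u v : Word} → T (does (u ≟W v)) → u ≡ v
  ≟W-sound {u} {v} h with u ≟W v
  ... | yes u≡v = u≡v

  ≟W-complete : ∀ {u v : Word} → u ≡ v → T (does (u ≟W v))
  ≟W-complete {u} {v} u≡v with u ≟W v
  ... | yes _ = tt
  ... | no u≢v = u≢v u≡v

  ≡ᵇ-refl : ∀ n → (n ≡ᵇ n) ≡ true
  ≡ᵇ-refl n = T⇒≡true (≡⇒≡ᵇ n n refl)

  ≡ᵇ-sym : ∀ a b → (a ≡ᵇ b) ≡ (b ≡ᵇ a)
  ≡ᵇ-sym a b = T-ext (λ h → ≡⇒≡ᵇ b a (sym (≡ᵇ⇒≡ a b h))) (λ h → ≡⇒≡ᵇ a b (sym (≡ᵇ⇒≡ b a h)))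

  ≢⇒≡ᵇ≡false : ∀ a b → ¬ a ≡ b → (a ≡ᵇ b) ≡ false
  ≢⇒≡ᵇ≡false a b a≢b = ¬T⇒≡false (λ h → a≢b (≡ᵇ⇒≡ a b h))

  ≡ᵇ≡false⇒≢ : ∀ a b → (a ≡ᵇ b) ≡ false → ¬ a ≡ b
  ≡ᵇ≡false⇒≢ a .a e refl with trans (sym e) (≡ᵇ-refl a)
  ... | ()

  ∧-leftComm : ∀ a b c → (a ∧ (b ∧ c)) ≡ (b ∧ (a ∧ c))
  ∧-leftComm = solve 3 (λ a b c → a ⊕ (b ⊕ c) ⊜ b ⊕ (a ⊕ c)) refl

  ∧-shuffle₄ : ∀ a b c d → (a ∧ (b ∧ (c ∧ d))) ≡ (b ∧ ((a ∧ c) ∧ d))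
  ∧-shuffle₄ = solve 4 (λ a b c d → a ⊕ (b ⊕ (c ⊕ d)) ⊜ b ⊕ ((a ⊕ c) ⊕ d)) refl

  ∧-shuffle₅ : ∀ a b c d e → ((a ∧ b) ∧ (c ∧ (d ∧ e))) ≡ (c ∧ ((a ∧ d) ∧ (b ∧ e)))
  ∧-shuffle₅ = solve 5 (λ a b c d e → (a ⊕ b) ⊕ (c ⊕ (d ⊕ e)) ⊜ c ⊕ ((a ⊕ d) ⊕ (b ⊕ e))) refl


module Packing where

  open import Data.Nat using (ℕ; zero; suc; _+_; _∸_; _≤_; _<_; _≤?_; _<?_; z≤n; s≤s; s≤s⁻¹)
  open import Data.Nat.Properties
  open import Data.List using (List; []; _∷_; map; filter; length)
  open import Data.List.Properties using (length-filter; length-deduplicate; length-map; map-∘; map-id; map-cong-local; filter-some; filter-none; ∷-injective)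
  open import Data.List.Membership.Propositional using (_∈_)
  open import Data.List.Membership.Propositional.Properties using (∈-filter⁺; ∈-filter⁻; ∈-deduplicate⁺; ∈-deduplicate⁻; ∈-map⁺; ∈-map⁻)
  open import Data.List.Membership.DecPropositional _≟_ using (_∈?_)
  open import Data.List.Relation.Unary.Any using (here; there)
  import Data.List.Relation.Unary.Any as Any
  open import Data.List.Relation.Unary.All using (All; []; _∷_)
  import Data.List.Relation.Unary.All as All
  open import Data.List.Relation.Unary.AllPairs using (_∷_)
  open import Data.List.Relation.Unary.Unique.Propositional using (Unique)
  import Data.List.Relation.Unary.Unique.Propositional.Properties as Unique
  open import Data.Product using (_×_; _,_; proj₁; proj₂)
  open import Data.Empty using (⊥-elim)
  open import Relation.Nullary using (yes; no)
  open import Relation.Binary.PropositionalEquality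
  open import Function using (_∘_; _⇔_; mk⇔; Equivalence)
  open import Defs using (pck; maxW)
  open FilterDedup

  rank : List ℕ → ℕ → ℕ
  rank w a = length (dedup (filter (_≤? a) w))

  rank-dedup : ∀ w a → rank w a ≡ length (filter (_≤? a) (dedup w))
  rank-dedup w a = cong length (dedup-filter (_≤? a) w)

  rank-mono : ∀ w {a b} → a ≤ b → rank w a ≤ rank w b
  rank-mono w {a} {b} a≤b rewrite rank-dedup w a | rank-dedup w b =
    length-filter-⊆ (_≤? a) (_≤? b) (λ x≤a → ≤-trans x≤a a≤b) (dedup w)

  rank-< : ∀ w {a b} → a < b → b ∈ w → rank w a < rank w b
  rank-< w {a} {b} a<b b∈ rewrite rank-dedup w a | rank-dedup w b =
    length-filter-⊂ (_≤? a) (_≤? b) (λ x≤a → ≤-trans x≤a (<⇒≤ a<b)) (dedup w) b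
      (∈-deduplicate⁺ _≟_ b∈) ≤-refl (<⇒≱ a<b)

  rank-positive : ∀ w {a} → a ∈ w → 1 ≤ rank w a
  rank-positive w {a} a∈ rewrite rank-dedup w a =
    filter-some (_≤? a) (Any.map (λ e → subst (_≤ a) e ≤-refl) (∈-deduplicate⁺ _≟_ a∈))

  rank-≤-length : ∀ w a → rank w a ≤ length w
  rank-≤-length w a = ≤-trans (length-deduplicate _≟_ (filter (_≤? a) w)) (length-filter (_≤? a) w)

  rank-reflects-< : ∀ w {a b} → b ∈ w → rank w a < rank w b → a < b
  rank-reflects-< w {a} {b} b∈ lt with a <? b
  ... | yes a<b = a<b
  ... | no a≮b = ⊥-elim (<⇒≱ lt (rank-mono w (≮⇒≥ a≮b)))

  rank-reflects-≤ : ∀ w {a b} → a ∈ w → rank w a ≤ rank w b → a ≤ b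
  rank-reflects-≤ w {a} {b} a∈ le with a ≤? b
  ... | yes a≤b = a≤b
  ... | no a≰b = ⊥-elim (<⇒≱ (rank-< w (≰⇒> a≰b) a∈) le)

  rank-injective : ∀ w {a b} → a ∈ w → b ∈ w → rank w a ≡ rank w b → a ≡ b
  rank-injective w a∈ b∈ e =
    ≤-antisym (rank-reflects-≤ w a∈ (≤-reflexive e)) (rank-reflects-≤ w b∈ (≤-reflexive (sym e)))

  map-cong-∈ : ∀ {A B : Set} {f g : A → B} (xs : List A) → (∀ {a} → a ∈ xs → f a ≡ g a) → map f xs ≡ map g xs
  map-cong-∈ xs f≡g = map-cong-local (All.tabulate f≡g)

  map≡id⇒fixed : ∀ {A : Set} {f : A → A} (xs : List A) → map f xs ≡ xs → ∀ {a} → a ∈ xs → f a ≡ a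
  map≡id⇒fixed (x ∷ xs) e (here refl) = proj₁ (∷-injective e)
  map≡id⇒fixed (x ∷ xs) e (there a∈) = map≡id⇒fixed xs (proj₂ (∷-injective e)) a∈

  rank-pck : ∀ w {a} → a ∈ w → rank (pck w) (rank w a) ≡ rank w a
  rank-pck w {a} a∈ = begin
      length (dedup (filter (_≤? rank w a) (map (rank w) w)))
        ≡⟨ cong (length ∘ dedup) (filter-map (_≤? rank w a) (rank w) w) ⟩
      length (dedup (map (rank w) (filter ((_≤? rank w a) ∘ rank w) w)))
        ≡⟨ cong (length ∘ dedup ∘ map (rank w)) (filter-≐-local ((_≤? rank w a) ∘ rank w) (_≤? a) w
             (λ b∈ → mk⇔ (rank-reflects-≤ w b∈) (rank-mono w))) ⟩
      length (dedup (map (rank w) (filter (_≤? a) w)))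
        ≡⟨ cong length (dedup-map (rank w) (filter (_≤? a) w)
             (λ x∈ y∈ → rank-injective w (proj₁ (∈-filter⁻ (_≤? a) x∈)) (proj₁ (∈-filter⁻ (_≤? a) y∈)))) ⟩
      length (map (rank w) (dedup (filter (_≤? a) w)))
        ≡⟨ length-map (rank w) (dedup (filter (_≤? a) w)) ⟩
      rank w a ∎
    where open ≡-Reasoning

  rank-shift : ∀ K v a → rank (map (K +_) v) (K + a) ≡ rank v a
  rank-shift K v a = begin
      length (dedup (filter (_≤? K + a) (map (K +_) v)))
        ≡⟨ cong (length ∘ dedup) (filter-map (_≤? K + a) (K +_) v) ⟩
      length (dedup (map (K +_) (filter ((_≤? K + a) ∘ (K +_)) v)))
        ≡⟨ cong (length ∘ dedup ∘ map (K +_)) (filter-≐-local ((_≤? K + a) ∘ (K +_)) (_≤? a) v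
             (λ _ → mk⇔ (+-cancelˡ-≤ K _ _) (+-monoʳ-≤ K))) ⟩
      length (dedup (map (K +_) (filter (_≤? a) v)))
        ≡⟨ cong length (dedup-map (K +_) (filter (_≤? a) v) (λ _ _ → +-cancelˡ-≡ K _ _)) ⟩
      length (map (K +_) (dedup (filter (_≤? a) v)))
        ≡⟨ length-map (K +_) (dedup (filter (_≤? a) v)) ⟩
      rank v a ∎
    where open ≡-Reasoning

  pck-idem : ∀ w → pck (pck w) ≡ pck w
  pck-idem w = trans (sym (map-∘ w)) (map-cong-∈ w (rank-pck w))

  pck-shift : ∀ K v → pck (map (K +_) v) ≡ pck v
  pck-shift K v = trans (sym (map-∘ v)) (map-cong-∈ v (λ {a} _ → rank-shift K v a))

  length-unique-interval : ∀ a xs → Unique xs → (∀ {x} → x ∈ xs ⇔ (1 ≤ x × x ≤ a)) → length xs ≡ a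
  length-unique-interval zero [] u h = refl
  length-unique-interval zero (x ∷ xs) u h with Equivalence.to h (here refl)
  ... | 1≤x , x≤0 = ⊥-elim (<⇒≱ 1≤x x≤0)
  length-unique-interval (suc a) xs u h =
    trans (length-remove-∈ (suc a) xs u (Equivalence.from h (s≤s z≤n , ≤-refl)))
      (cong suc (length-unique-interval a (filter (≢? (suc a)) xs) (Unique.filter⁺ (≢? (suc a)) u) (mk⇔ to from)))
    where
    to : ∀ {x} → x ∈ filter (≢? (suc a)) xs → 1 ≤ x × x ≤ a
    to x∈ with ∈-filter⁻ (≢? (suc a)) x∈
    ... | x∈xs , x≢ with Equivalence.to h x∈xs
    ... | 1≤x , x≤1+a = 1≤x , s≤s⁻¹ (≤∧≢⇒< x≤1+a (λ e → x≢ (sym e)))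
    from : ∀ {x} → 1 ≤ x × x ≤ a → x ∈ filter (≢? (suc a)) xs
    from (1≤x , x≤a) = ∈-filter⁺ (≢? (suc a)) (Equivalence.from h (1≤x , m≤n⇒m≤1+n x≤a)) (λ e → <⇒≢ (s≤s x≤a) (sym e))

  length-unique-bounded : ∀ n xs → Unique xs → All (_< n) xs → length xs ≤ n
  length-unique-bounded zero [] u a = z≤n
  length-unique-bounded zero (x ∷ xs) u (() ∷ a)
  length-unique-bounded (suc n) xs u all<
    = ≤-trans (length-remove-≤ n xs u) (s≤s (length-unique-bounded n _ (Unique.filter⁺ (≢? n) u) (All.tabulate below)))
    where
    below : ∀ {x} → x ∈ filter (≢? n) xs → x < n
    below x∈ with ∈-filter⁻ (≢? n) x∈
    ... | x∈xs , x≢n = ≤∧≢⇒< (s≤s⁻¹ (All.lookup all< x∈xs)) (λ e → x≢n (sym e))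

  Gapless : List ℕ → Set
  Gapless l = All (1 ≤_) l × (∀ {b y} → 1 ≤ b → y ∈ l → b ≤ y → b ∈ l)

  packed⇒rank-fixed : ∀ u → pck u ≡ u → ∀ {a} → a ∈ u → rank u a ≡ a
  packed⇒rank-fixed u = map≡id⇒fixed u

  packed⇒gapless : ∀ u → pck u ≡ u → Gapless u
  packed⇒gapless u packed = All.tabulate positive , downClosed
    where
    positive : ∀ {x} → x ∈ u → 1 ≤ x
    positive x∈ = subst (1 ≤_) (packed⇒rank-fixed u packed x∈) (rank-positive u x∈)
    -- A missing letter b ≤ y would give y + 1 distinct values 0, b and the letters ≤ y, all below y + 1.
    downClosed : ∀ {b y} → 1 ≤ b → y ∈ u → b ≤ y → b ∈ u
    downClosed {b} {y} 1≤b y∈ b≤y with b ∈? u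
    ... | yes b∈ = b∈
    ... | no b∉ = ⊥-elim (<⇒≱ (s≤s ≤-refl) (subst (λ r → suc (suc r) ≤ suc y) (packed⇒rank-fixed u packed y∈) bound))
      where
      D = dedup (filter (_≤? y) u)
      inD : ∀ {x} → x ∈ D → x ∈ u × x ≤ y
      inD x∈ = ∈-filter⁻ (_≤? y) (∈-deduplicate⁻ _≟_ (filter (_≤? y) u) x∈)
      unique : Unique (0 ∷ b ∷ D)
      unique = ((λ e → <⇒≢ 1≤b e) ∷ All.tabulate (λ x∈ e → <⇒≢ (positive (proj₁ (inD x∈))) e))
             ∷ (All.tabulate (λ x∈ e → b∉ (subst (_∈ u) (sym e) (proj₁ (inD x∈)))) ∷ dedup-unique (filter (_≤? y) u))
      bound : suc (suc (rank u y)) ≤ suc y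
      bound = length-unique-bounded (suc y) (0 ∷ b ∷ D) unique
                (s≤s z≤n ∷ s≤s b≤y ∷ All.tabulate (λ x∈ → s≤s (proj₂ (inD x∈))))

  gapless⇒packed : ∀ u → Gapless u → pck u ≡ u
  gapless⇒packed u (positive , downClosed) = trans (map-cong-∈ u fixed) (map-id u)
    where
    fixed : ∀ {a} → a ∈ u → rank u a ≡ a
    fixed {a} a∈ = length-unique-interval a (dedup (filter (_≤? a) u)) (dedup-unique _) (mk⇔ to from)
      where
      to : ∀ {x} → x ∈ dedup (filter (_≤? a) u) → 1 ≤ x × x ≤ a
      to x∈ with ∈-filter⁻ (_≤? a) (∈-deduplicate⁻ _≟_ (filter (_≤? a) u) x∈)
      ... | x∈u , x≤a = All.lookup positive x∈u , x≤a
      from : ∀ {x} → 1 ≤ x × x ≤ a → x ∈ dedup (filter (_≤? a) u)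
      from (1≤x , x≤a) = ∈-deduplicate⁺ _≟_ (∈-filter⁺ (_≤? a) (downClosed 1≤x a∈ x≤a) x≤a)

  ≤-maxW : ∀ {x} l → x ∈ l → x ≤ maxW l
  ≤-maxW (y ∷ l) (here refl) = m≤m⊔n y (maxW l)
  ≤-maxW (y ∷ l) (there x∈) = ≤-trans (≤-maxW l x∈) (m≤n⊔m y (maxW l))

  maxW-lub : ∀ {n} l → All (_≤ n) l → maxW l ≤ n
  maxW-lub [] [] = z≤n
  maxW-lub (y ∷ l) (y≤n ∷ l≤n) = ⊔-lub y≤n (maxW-lub l l≤n)

  maxW-∈ : ∀ l → 0 < maxW l → maxW l ∈ l
  maxW-∈ (x ∷ l) pos with x ≤? maxW l
  ... | yes le rewrite m≤n⇒m⊔n≡n le = there (maxW-∈ l pos)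
  ... | no gt rewrite m≥n⇒m⊔n≡m (<⇒≤ (≰⇒> gt)) = here refl

  maxW-filter : ∀ {P : ℕ → Set} (P? : ∀ x → Relation.Nullary.Dec (P x)) l → maxW (filter P? l) ≤ maxW l
  maxW-filter P? l = maxW-lub (filter P? l) (All.tabulate (λ x∈ → ≤-maxW l (proj₁ (∈-filter⁻ P? {xs = l} x∈))))

  maxW-filter-≤ : ∀ u → pck u ≡ u → ∀ k → k ≤ maxW u → maxW (filter (_≤? k) u) ≡ k
  maxW-filter-≤ u packed zero le
    rewrite filter-none (_≤? 0) (All.map (λ p q → <⇒≱ p q) (proj₁ (packed⇒gapless u packed))) = refl
  maxW-filter-≤ u packed (suc k) le =
    ≤-antisym (maxW-lub _ (All.tabulate (λ x∈ → proj₂ (∈-filter⁻ (_≤? suc k) {xs = u} x∈))))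
              (≤-maxW _ (∈-filter⁺ (_≤? suc k) 1+k∈u ≤-refl))
    where
    1+k∈u : suc k ∈ u
    1+k∈u = proj₂ (packed⇒gapless u packed) (s≤s z≤n) (maxW-∈ u (≤-trans (s≤s z≤n) le)) le

  filter->-shift : ∀ u K → Gapless u → filter (K <?_) u ≡ map (K +_) (pck (filter (K <?_) u))
  filter->-shift u K (positive , downClosed) = begin
      F                                 ≡⟨ sym F≡K+v ⟩
      map (K +_) v                      ≡⟨ cong (map (K +_)) (sym (gapless⇒packed v v-gapless)) ⟩
      map (K +_) (pck v)                ≡⟨ cong (map (K +_)) (sym (pck-shift K v)) ⟩
      map (K +_) (pck (map (K +_) v))   ≡⟨ cong (λ z → map (K +_) (pck z)) F≡K+v ⟩
      map (K +_) (pck F)                ∎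
    where
    open ≡-Reasoning
    F = filter (K <?_) u
    v = map (_∸ K) F
    F≡K+v : map (K +_) v ≡ F
    F≡K+v = trans (sym (map-∘ F))
              (trans (map-cong-∈ F (λ x∈ → m+[n∸m]≡n (<⇒≤ (proj₂ (∈-filter⁻ (K <?_) {xs = u} x∈))))) (map-id F))
    v-gapless : Gapless v
    v-gapless = All.tabulate pos , down
      where
      pos : ∀ {x} → x ∈ v → 1 ≤ x
      pos x∈ with ∈-map⁻ (_∸ K) x∈
      ... | y , y∈ , refl = m<n⇒0<n∸m (proj₂ (∈-filter⁻ (K <?_) {xs = u} y∈))
      down : ∀ {b y} → 1 ≤ b → y ∈ v → b ≤ y → b ∈ v
      down {b} 1≤b y∈ b≤y with ∈-map⁻ (_∸ K) y∈
      ... | x , x∈ , refl with ∈-filter⁻ (K <?_) {xs = u} x∈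
      ... | x∈u , K<x = subst (_∈ v) (m+n∸m≡n K b) (∈-map⁺ (_∸ K) (∈-filter⁺ (K <?_) K+b∈u (m<m+n K 1≤b)))
        where
        K+b∈u : K + b ∈ u
        K+b∈u = downClosed (≤-trans 1≤b (m≤n+m b K)) x∈u
                  (subst (K + b ≤_) (m+[n∸m]≡n (<⇒≤ K<x)) (+-monoʳ-≤ K b≤y))


module CompatCheck where

  open import Data.Nat using (ℕ; zero; suc; _+_; _∸_; _≤_; _≤?_; _<ᵇ_; _≡ᵇ_)
  open import Data.Nat.Properties
    using (_≟_; suc-injective; m≤m+n; m+n∸m≡n; <⇒<ᵇ; <ᵇ⇒<; ≤-reflexive; <⇒≤; ≰⇒>; +-identityʳ; +-assoc; ≡⇒≡ᵇ; ≡ᵇ⇒≡; m≤n⇒m⊓n≡m)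
  open import Data.Bool using (Bool; true; false; _∧_; T)
  open import Data.Unit using (tt)
  open import Data.Maybe using (Maybe; just; nothing)
  open import Data.List using (List; []; _∷_; _++_; length; take; drop; null)
  open import Data.List.Properties using (take++drop≡id; ++-identityʳ; ++-assoc; drop-drop; length-drop; take-all; drop-all; take-take; take-drop)
  open import Data.Bool.Properties using (∧-identityʳ; ∧-zeroʳ; ∧-assoc)
  open import Data.Vec using (Vec; []; _∷_)
  open import Data.List.Relation.Unary.All using (All; []; _∷_)
  import Data.List.Relation.Unary.All.Properties as All
  open import Data.Product using (_×_; _,_; proj₁; proj₂)
  open import Data.Empty using (⊥-elim)
  open import Relation.Nullary using (yes; no; does)
  open import Relation.Binary.PropositionalEquality
  open import Function using (_⇔_; mk⇔; Equivalence)
  open import Defs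
  open TakeDrop
  open BoolFacts

  above : Maybe ℕ → ℕ → Bool
  above nothing x = true
  above (just y) x = y <ᵇ x

  -- A structural version of Compat: a term reads its root letter, then its subterms read
  -- consecutive windows of the rest of the word; the root must lie above the parent's letter.
  module _ {S : Signature} where

    mutual
      termCompat : Maybe ℕ → Term S → Word → Bool
      termCompat b ⊥t w = null w
      termCompat b (node g us) [] = false
      termCompat b (node g us) (x ∷ w) = above b x ∧ childrenCompat x us w

      childrenCompat : ∀ {n} → ℕ → Vec (Term S) n → Word → Bool
      childrenCompat x [] w = null w
      childrenCompat x (t ∷ ts) w = termCompat (just x) t (take (size t) w) ∧ childrenCompat x ts (drop (size t) w)

    forestCompat : Forest S → Word → Bool
    forestCompat [] w = null w
    forestCompat ((g , us) ∷ f) w =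
      termCompat nothing (node g us) (take (suc (sizes us)) w) ∧ forestCompat f (drop (suc (sizes us)) w)

    mutual
      termCompat-length : ∀ b t w → T (termCompat b t w) → length w ≡ size t
      termCompat-length b ⊥t [] h = refl
      termCompat-length b (node g us) (x ∷ w) h =
        cong suc (childrenCompat-length x us w (proj₂ (T-∧⁻ {above b x} h)))

      childrenCompat-length : ∀ {n} x (us : Vec (Term S) n) w → T (childrenCompat x us w) → length w ≡ sizes us
      childrenCompat-length x [] [] h = refl
      childrenCompat-length x (t ∷ ts) w h with T-∧⁻ {termCompat (just x) t (take (size t) w)} h
      ... | h₁ , h₂ = trans (length-take+drop (size t) w)
                        (cong₂ _+_ (termCompat-length (just x) t _ h₁) (childrenCompat-length x ts _ h₂))

    forestCompat-length : ∀ f w → T (forestCompat f w) → length w ≡ dg f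
    forestCompat-length [] [] h = refl
    forestCompat-length ((g , us) ∷ f) w h with T-∧⁻ {termCompat nothing (node g us) (take (suc (sizes us)) w)} h
    ... | h₁ , h₂ = trans (length-take+drop (suc (sizes us)) w)
                      (cong₂ _+_ (termCompat-length nothing (node g us) (take (suc (sizes us)) w) h₁) (forestCompat-length f _ h₂))

  nth-drop : ∀ q (x : Word) {b r} → drop q x ≡ b ∷ r → nth x q ≡ just b
  nth-drop zero (y ∷ x) refl = refl
  nth-drop (suc q) (y ∷ x) e = nth-drop q x e

  drop-suc : ∀ q (x : Word) {b r} → drop q x ≡ b ∷ r → drop (suc q) x ≡ r
  drop-suc zero (y ∷ x) refl = refl
  drop-suc (suc q) (y ∷ x) e = drop-suc q x e

  record WindowSplit (x : Word) (q n m : ℕ) (b : ℕ) (v′ rest : Word) : Set where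
    field
      root       : nth x q ≡ just b
      firstBlock : drop (suc q) x ≡ take n v′ ++ (drop n v′ ++ rest)
      afterBlock : drop (q + suc n) x ≡ drop n v′ ++ rest
      firstLength : length (take n v′) ≡ n
      afterLength : length (drop n v′) ≡ m

  windowSplit : ∀ x q n m {b} v′ rest → drop q x ≡ (b ∷ v′) ++ rest → length v′ ≡ n + m →
                WindowSplit x q n m b v′ rest
  windowSplit x q n m {b} v′ rest window len = record
    { root = nth-drop q x window
    ; firstBlock = trans (drop-suc q x window)
                     (trans (cong (_++ rest) (sym (take++drop≡id n v′))) (++-assoc (take n v′) (drop n v′) rest))
    ; afterBlock = trans (sym (drop-drop q (suc n) x)) (trans (cong (drop (suc n)) window) (drop-++ n v′ rest n≤))
    ; firstLength = length-take≤ n v′ n≤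
    ; afterLength = trans (length-drop n v′) (trans (cong (_∸ n) len) (m+n∸m≡n n m))
    }
    where n≤ = subst (n ≤_) (sym len) (m≤m+n n m)

  Increasing : Word → ℕ × ℕ → Set
  Increasing x e = ltM (nth x (proj₁ e)) (nth x (proj₂ e))

  module _ {S : Signature} where

    childEdges-increasing : ∀ {n} (x : Word) p q (us : Vec (Term S) n) v rest a → nth x p ≡ just a →
                            drop q x ≡ v ++ rest → length v ≡ sizes us →
                            All (Increasing x) (childEdges p q us) ⇔ T (childrenCompat a us v)
    childEdges-increasing x p q [] [] rest a xp≡a window len = mk⇔ (λ _ → tt) (λ _ → [])
    childEdges-increasing x p q (⊥t ∷ us) v rest a xp≡a window len =
      childEdges-increasing x p q us v rest a xp≡a window len
    childEdges-increasing x p q (node g ws ∷ us) (b ∷ v′) rest a xp≡a window len = mk⇔ to from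
      where
      n = sizes ws
      open WindowSplit (windowSplit x q n (sizes us) v′ rest window (suc-injective len))
      grandchildren = childEdges-increasing x q (suc q) ws (take n v′) (drop n v′ ++ rest) b root firstBlock firstLength
      siblings = childEdges-increasing x p (q + suc n) us (drop n v′) rest a xp≡a afterBlock afterLength
      to : All (Increasing x) (childEdges p q (node g ws ∷ us)) → T (childrenCompat a (node g ws ∷ us) (b ∷ v′))
      to h with All.++⁻ ((p , q) ∷ childEdges q (suc q) ws) h
      ... | a<b ∷ h₁ , h₂ = T-∧⁺ (T-∧⁺ (<⇒<ᵇ (subst₂ ltM xp≡a root a<b)) (Equivalence.to grandchildren h₁))
                                  (Equivalence.to siblings h₂)
      from : T (childrenCompat a (node g ws ∷ us) (b ∷ v′)) → All (Increasing x) (childEdges p q (node g ws ∷ us))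
      from h with T-∧⁻ {(a <ᵇ b) ∧ childrenCompat b ws (take n v′)} h
      ... | h₁₂ , h₃ with T-∧⁻ {a <ᵇ b} h₁₂
      ... | h₁ , h₂ = All.++⁺ (subst₂ ltM (sym xp≡a) (sym root) (<ᵇ⇒< a b h₁) ∷ Equivalence.from grandchildren h₂)
                              (Equivalence.from siblings h₃)

    forestEdges-increasing : ∀ (x : Word) o (f : Forest S) v rest → drop o x ≡ v ++ rest → length v ≡ dg f →
                             All (Increasing x) (forestEdges′ o f) ⇔ T (forestCompat f v)
    forestEdges-increasing x o [] [] rest window len = mk⇔ (λ _ → tt) (λ _ → [])
    forestEdges-increasing x o ((g , ts) ∷ f) (b ∷ v′) rest window len = mk⇔ to from
      where
      n = sizes ts
      open WindowSplit (windowSplit x o n (dg f) v′ rest window (suc-injective len))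
      children = childEdges-increasing x o (suc o) ts (take n v′) (drop n v′ ++ rest) b root firstBlock firstLength
      others = forestEdges-increasing x (o + suc n) f (drop n v′) rest afterBlock afterLength
      to : All (Increasing x) (forestEdges′ o ((g , ts) ∷ f)) → T (forestCompat ((g , ts) ∷ f) (b ∷ v′))
      to h with All.++⁻ (childEdges o (suc o) ts) h
      ... | h₁ , h₂ = T-∧⁺ (Equivalence.to children h₁) (Equivalence.to others h₂)
      from : T (forestCompat ((g , ts) ∷ f) (b ∷ v′)) → All (Increasing x) (forestEdges′ o ((g , ts) ∷ f))
      from h with T-∧⁻ {childrenCompat b ts (take n v′)} h
      ... | h₁ , h₂ = All.++⁺ (Equivalence.from children h₁) (Equivalence.from others h₂)

    Compat⇔forestCompat : ∀ (f : Forest S) w → Compat f w ⇔ T (forestCompat f w)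
    Compat⇔forestCompat f w = mk⇔ to from
      where
      edges = forestEdges-increasing w 0 f w [] (sym (++-identityʳ w))
      to : Compat f w → T (forestCompat f w)
      to (len , increasing) = Equivalence.to (edges len) increasing
      from : T (forestCompat f w) → Compat f w
      from h = forestCompat-length f w h , Equivalence.from (edges (forestCompat-length f w h)) h

    does-Compat? : ∀ (f : Forest S) w → does (Compat? f w) ≡ forestCompat f w
    does-Compat? f w = does≡ (Compat? f w) (Compat⇔forestCompat f w)

  module _ {S : Signature} where

    termCompat-prefix : ∀ b (t : Term S) w → termCompat b t w ≡ (termCompat b t (take (size t) w) ∧ null (drop (size t) w))
    termCompat-prefix b t w with length w ≟ size t
    ... | yes e rewrite take-all (size t) w (≤-reflexive e) | drop-all (size t) w (≤-reflexive e) =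
          sym (∧-identityʳ _)
    ... | no ne with termCompat b t w in eq
    ...   | true = ⊥-elim (ne (termCompat-length b t w (subst T (sym eq) tt)))
    ...   | false with size t ≤? length w
    ...     | no gt rewrite take-all (size t) w (<⇒≤ (≰⇒> gt)) | eq = refl
    ...     | yes le with drop (size t) w in eq₂
    ...       | [] = ⊥-elim (ne (trans (length-take+drop (size t) w)
                       (trans (cong₂ _+_ (length-take≤ (size t) w le) (cong length eq₂)) (+-identityʳ (size t)))))
    ...       | _ ∷ _ = sym (∧-zeroʳ _)

    childrenCompat-prefix : ∀ {n} x (us : Vec (Term S) n) w →
      childrenCompat x us w ≡ ((length w ≡ᵇ sizes us) ∧ (childrenCompat x us (take (sizes us) w) ∧ null (drop (sizes us) w)))
    childrenCompat-prefix x us w with length w ≟ sizes us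
    ... | yes e rewrite e | take-all (sizes us) w (≤-reflexive e) | drop-all (sizes us) w (≤-reflexive e)
                  | T⇒≡true (≡⇒≡ᵇ (sizes us) (sizes us) refl) = sym (∧-identityʳ _)
    ... | no ne rewrite ¬T⇒≡false {length w ≡ᵇ sizes us} (λ h → ne (≡ᵇ⇒≡ _ _ h)) with childrenCompat x us w in eq
    ...   | true = ⊥-elim (ne (childrenCompat-length x us w (subst T (sym eq) tt)))
    ...   | false = refl

    forestCompat-++ : ∀ (f g : Forest S) w →
      forestCompat (f ++ g) w ≡ (forestCompat f (take (dg f) w) ∧ forestCompat g (drop (dg f) w))
    forestCompat-++ [] g w = refl
    forestCompat-++ ((h , us) ∷ f) g w
      rewrite forestCompat-++ f g (drop (suc (sizes us)) w)
            | take-take (suc (sizes us)) (suc (sizes us) + dg f) w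
            | m≤n⇒m⊓n≡m (m≤m+n (suc (sizes us)) (dg f))
            | sym (take-drop (dg f) (suc (sizes us)) w)
            | drop-drop (suc (sizes us)) (dg f) w
            = sym (∧-assoc (termCompat nothing (node h us) (take (suc (sizes us)) w))
                           (forestCompat f (take (dg f) (drop (suc (sizes us)) w)))
                           (forestCompat g (drop (suc (sizes us + dg f)) w)))

    dg-++ : ∀ (f g : Forest S) → dg (f ++ g) ≡ dg f + dg g
    dg-++ [] g = refl
    dg-++ ((h , us) ∷ f) g = trans (cong (suc (sizes us) +_) (dg-++ f g)) (sym (+-assoc (suc (sizes us)) (dg f) (dg g)))


-- A tagged word records a shuffle of two words: inj₁ marks letters of the left word, inj₂ those of the right one.
module TaggedWords where

  open import Data.Nat using (ℕ; zero; suc; _+_; _<_)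
  open import Data.Nat.Properties using (+-suc)
  open import Data.Bool using (Bool; true; false; _∧_; T)
  open import Data.Unit using (⊤; tt)
  open import Data.Sum using (_⊎_; inj₁; inj₂)
  open import Data.Maybe using (Maybe; just; nothing)
  open import Data.List using (List; []; _∷_; _++_; map; length; take; drop; null; replicate)
  open import Data.List.Properties using (take++drop≡id)
  open import Data.List.Membership.Propositional using (_∈_)
  open import Data.List.Relation.Unary.Any using (here; there)
  open import Data.List.Relation.Unary.All using (All; []; _∷_)
  import Data.List.Relation.Unary.All as All
  import Data.List.Relation.Unary.All.Properties as AP
  open import Data.Product using (_×_; _,_; proj₁; proj₂)
  open import Relation.Binary.PropositionalEquality
  open TakeDrop

  Tagged : Set
  Tagged = List (ℕ ⊎ ℕ)

  erase : Tagged → List ℕ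
  erase [] = []
  erase (inj₁ x ∷ z) = x ∷ erase z
  erase (inj₂ y ∷ z) = y ∷ erase z

  lefts : Tagged → List ℕ
  lefts [] = []
  lefts (inj₁ x ∷ z) = x ∷ lefts z
  lefts (inj₂ y ∷ z) = lefts z

  rights : Tagged → List ℕ
  rights [] = []
  rights (inj₁ x ∷ z) = rights z
  rights (inj₂ y ∷ z) = y ∷ rights z

  mask : Tagged → List Bool
  mask [] = []
  mask (inj₁ _ ∷ z) = true ∷ mask z
  mask (inj₂ _ ∷ z) = false ∷ mask z

  #true : List Bool → ℕ
  #true [] = 0
  #true (true ∷ m) = suc (#true m)
  #true (false ∷ m) = #true m

  #false : List Bool → ℕ
  #false [] = 0
  #false (true ∷ m) = #false m
  #false (false ∷ m) = suc (#false m)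

  allFalse : List Bool → Bool
  allFalse [] = true
  allFalse (true ∷ m) = false
  allFalse (false ∷ m) = allFalse m

  take-erase : ∀ n z → take n (erase z) ≡ erase (take n z)
  take-erase zero z = refl
  take-erase (suc n) [] = refl
  take-erase (suc n) (inj₁ x ∷ z) = cong (x ∷_) (take-erase n z)
  take-erase (suc n) (inj₂ x ∷ z) = cong (x ∷_) (take-erase n z)

  drop-erase : ∀ n z → drop n (erase z) ≡ erase (drop n z)
  drop-erase zero z = refl
  drop-erase (suc n) [] = refl
  drop-erase (suc n) (inj₁ x ∷ z) = drop-erase n z
  drop-erase (suc n) (inj₂ x ∷ z) = drop-erase n z

  take-mask : ∀ n z → take n (mask z) ≡ mask (take n z)
  take-mask zero z = refl
  take-mask (suc n) [] = refl
  take-mask (suc n) (inj₁ x ∷ z) = cong (true ∷_) (take-mask n z)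
  take-mask (suc n) (inj₂ x ∷ z) = cong (false ∷_) (take-mask n z)

  drop-mask : ∀ n z → drop n (mask z) ≡ mask (drop n z)
  drop-mask zero z = refl
  drop-mask (suc n) [] = refl
  drop-mask (suc n) (inj₁ x ∷ z) = drop-mask n z
  drop-mask (suc n) (inj₂ x ∷ z) = drop-mask n z

  lefts-++ : ∀ z₁ z₂ → lefts (z₁ ++ z₂) ≡ lefts z₁ ++ lefts z₂
  lefts-++ [] z₂ = refl
  lefts-++ (inj₁ x ∷ z₁) z₂ = cong (x ∷_) (lefts-++ z₁ z₂)
  lefts-++ (inj₂ x ∷ z₁) z₂ = lefts-++ z₁ z₂

  rights-++ : ∀ z₁ z₂ → rights (z₁ ++ z₂) ≡ rights z₁ ++ rights z₂
  rights-++ [] z₂ = refl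
  rights-++ (inj₁ x ∷ z₁) z₂ = rights-++ z₁ z₂
  rights-++ (inj₂ x ∷ z₁) z₂ = cong (x ∷_) (rights-++ z₁ z₂)

  lefts-take-drop : ∀ n z → lefts z ≡ lefts (take n z) ++ lefts (drop n z)
  lefts-take-drop n z = trans (cong lefts (sym (take++drop≡id n z))) (lefts-++ (take n z) (drop n z))

  rights-take-drop : ∀ n z → rights z ≡ rights (take n z) ++ rights (drop n z)
  rights-take-drop n z = trans (cong rights (sym (take++drop≡id n z))) (rights-++ (take n z) (drop n z))

  #true-mask : ∀ z → #true (mask z) ≡ length (lefts z)
  #true-mask [] = refl
  #true-mask (inj₁ x ∷ z) = cong suc (#true-mask z)
  #true-mask (inj₂ x ∷ z) = #true-mask z

  #false-mask : ∀ z → #false (mask z) ≡ length (rights z)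
  #false-mask [] = refl
  #false-mask (inj₁ x ∷ z) = #false-mask z
  #false-mask (inj₂ x ∷ z) = cong suc (#false-mask z)

  allFalse-mask : ∀ z → allFalse (mask z) ≡ null (lefts z)
  allFalse-mask [] = refl
  allFalse-mask (inj₁ x ∷ z) = refl
  allFalse-mask (inj₂ x ∷ z) = allFalse-mask z

  lefts≡[]⇒erase≡rights : ∀ z → lefts z ≡ [] → erase z ≡ rights z
  lefts≡[]⇒erase≡rights [] e = refl
  lefts≡[]⇒erase≡rights (inj₂ x ∷ z) e = cong (x ∷_) (lefts≡[]⇒erase≡rights z e)

  lefts≡[]⇒length-mask : ∀ z → lefts z ≡ [] → length (mask z) ≡ length (rights z)
  lefts≡[]⇒length-mask [] e = refl
  lefts≡[]⇒length-mask (inj₂ x ∷ z) e = cong suc (lefts≡[]⇒length-mask z e)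

  #true-take-drop : ∀ n m → #true m ≡ #true (take n m) + #true (drop n m)
  #true-take-drop zero m = refl
  #true-take-drop (suc n) [] = refl
  #true-take-drop (suc n) (true ∷ m) = cong suc (#true-take-drop n m)
  #true-take-drop (suc n) (false ∷ m) = #true-take-drop n m

  #false-take-drop : ∀ n m → #false m ≡ #false (take n m) + #false (drop n m)
  #false-take-drop zero m = refl
  #false-take-drop (suc n) [] = refl
  #false-take-drop (suc n) (true ∷ m) = #false-take-drop n m
  #false-take-drop (suc n) (false ∷ m) = cong suc (#false-take-drop n m)

  allFalse⇒#true≡0 : ∀ m → T (allFalse m) → #true m ≡ 0
  allFalse⇒#true≡0 [] _ = refl
  allFalse⇒#true≡0 (false ∷ m) h = allFalse⇒#true≡0 m h

  allFalse⇒#false≡length : ∀ m → T (allFalse m) → #false m ≡ length m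
  allFalse⇒#false≡length [] _ = refl
  allFalse⇒#false≡length (false ∷ m) h = cong suc (allFalse⇒#false≡length m h)

  LeftsBelowRights : Tagged → Set
  LeftsBelowRights z = All (λ x → All (x <_) (rights z)) (lefts z)

  LeftsBelowRights-++ : ∀ z₁ z₂ → LeftsBelowRights (z₁ ++ z₂) → LeftsBelowRights z₁ × LeftsBelowRights z₂
  LeftsBelowRights-++ z₁ z₂ h rewrite lefts-++ z₁ z₂ | rights-++ z₁ z₂ with AP.++⁻ (lefts z₁) h
  ... | h₁ , h₂ = All.map (λ a → proj₁ (AP.++⁻ (rights z₁) a)) h₁ , All.map (λ a → proj₂ (AP.++⁻ (rights z₁) a)) h₂

  LeftsBelowRights-take-drop : ∀ n z → LeftsBelowRights z → LeftsBelowRights (take n z) × LeftsBelowRights (drop n z)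
  LeftsBelowRights-take-drop n z h = LeftsBelowRights-++ (take n z) (drop n z) (subst LeftsBelowRights (sym (take++drop≡id n z)) h)

  length≡#true+#false : ∀ m → length m ≡ #true m + #false m
  length≡#true+#false [] = refl
  length≡#true+#false (true ∷ m) = cong suc (length≡#true+#false m)
  length≡#true+#false (false ∷ m) = trans (cong suc (length≡#true+#false m)) (sym (+-suc (#true m) (#false m)))

  null-erase⇒[] : ∀ z → T (null (erase z)) → z ≡ []
  null-erase⇒[] [] _ = refl
  null-erase⇒[] (inj₁ _ ∷ z) ()
  null-erase⇒[] (inj₂ _ ∷ z) ()

  null-erase : ∀ z → null (erase z) ≡ null (mask z) ∧ (null (lefts z) ∧ null (rights z))
  null-erase [] = refl
  null-erase (inj₁ x ∷ z) = refl
  null-erase (inj₂ x ∷ z) = refl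

  lefts-inj₂ : ∀ c → lefts (map inj₂ c) ≡ []
  lefts-inj₂ [] = refl
  lefts-inj₂ (y ∷ c) = lefts-inj₂ c

  rights-inj₂ : ∀ c → rights (map inj₂ c) ≡ c
  rights-inj₂ [] = refl
  rights-inj₂ (y ∷ c) = cong (y ∷_) (rights-inj₂ c)

  lefts-inj₁ : ∀ c → lefts (map inj₁ c) ≡ c
  lefts-inj₁ [] = refl
  lefts-inj₁ (y ∷ c) = cong (y ∷_) (lefts-inj₁ c)

  rights-inj₁ : ∀ c → rights (map inj₁ c) ≡ []
  rights-inj₁ [] = refl
  rights-inj₁ (y ∷ c) = rights-inj₁ c

  erase-inj₂ : ∀ c → erase (map inj₂ c) ≡ c
  erase-inj₂ [] = refl
  erase-inj₂ (y ∷ c) = cong (y ∷_) (erase-inj₂ c)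

  erase-inj₁ : ∀ c → erase (map inj₁ c) ≡ c
  erase-inj₁ [] = refl
  erase-inj₁ (y ∷ c) = cong (y ∷_) (erase-inj₁ c)

  mask-inj₂ : ∀ c → mask (map inj₂ c) ≡ replicate (length c) false
  mask-inj₂ [] = refl
  mask-inj₂ (y ∷ c) = cong (false ∷_) (mask-inj₂ c)

  mask-inj₁ : ∀ c → mask (map inj₁ c) ≡ replicate (length c) true
  mask-inj₁ [] = refl
  mask-inj₁ (y ∷ c) = cong (true ∷_) (mask-inj₁ c)

  ∈-erase⁻ : ∀ z {x} → x ∈ erase z → x ∈ lefts z ⊎ x ∈ rights z
  ∈-erase⁻ (inj₁ y ∷ z) (here refl) = inj₁ (here refl)
  ∈-erase⁻ (inj₂ y ∷ z) (here refl) = inj₂ (here refl)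
  ∈-erase⁻ (inj₁ y ∷ z) (there x∈) with ∈-erase⁻ z x∈
  ... | inj₁ p = inj₁ (there p)
  ... | inj₂ p = inj₂ p
  ∈-erase⁻ (inj₂ y ∷ z) (there x∈) with ∈-erase⁻ z x∈
  ... | inj₁ p = inj₁ p
  ... | inj₂ p = inj₂ (there p)

  ∈-lefts⇒∈-erase : ∀ z {x} → x ∈ lefts z → x ∈ erase z
  ∈-lefts⇒∈-erase (inj₁ y ∷ z) (here refl) = here refl
  ∈-lefts⇒∈-erase (inj₁ y ∷ z) (there x∈) = there (∈-lefts⇒∈-erase z x∈)
  ∈-lefts⇒∈-erase (inj₂ y ∷ z) x∈ = there (∈-lefts⇒∈-erase z x∈)

  ∈-rights⇒∈-erase : ∀ z {x} → x ∈ rights z → x ∈ erase z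
  ∈-rights⇒∈-erase (inj₂ y ∷ z) (here refl) = here refl
  ∈-rights⇒∈-erase (inj₂ y ∷ z) (there x∈) = there (∈-rights⇒∈-erase z x∈)
  ∈-rights⇒∈-erase (inj₁ y ∷ z) x∈ = there (∈-rights⇒∈-erase z x∈)

  BlockSplit : ℕ → Tagged → ℕ → ℕ → Set
  BlockSplit n z sL sR =
    take sL (lefts z) ≡ lefts (take n z) × drop sL (lefts z) ≡ lefts (drop n z) ×
    take sR (rights z) ≡ rights (take n z) × drop sR (rights z) ≡ rights (drop n z)

  blockSplit : ∀ n z {sL sR} → sL ≡ length (lefts (take n z)) → sR ≡ length (rights (take n z)) → BlockSplit n z sL sR
  blockSplit n z {sL} {sR} eL eR =
    trans (cong (take sL) (lefts-take-drop n z)) (take-++-length _ _ sL eL) ,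
    trans (cong (drop sL) (lefts-take-drop n z)) (drop-++-length _ _ sL eL) ,
    trans (cong (take sR) (rights-take-drop n z)) (take-++-length _ _ sR eR) ,
    trans (cong (drop sR) (rights-take-drop n z)) (drop-++-length _ _ sR eR)

  RightsAbove : Maybe ℕ → Tagged → Set
  RightsAbove nothing z = ⊤
  RightsAbove (just x) z = All (x <_) (rights z)

  RightsAbove-take-drop : ∀ β n z → RightsAbove β z → RightsAbove β (take n z) × RightsAbove β (drop n z)
  RightsAbove-take-drop nothing n z h = tt , tt
  RightsAbove-take-drop (just x) n z h rewrite rights-take-drop n z = AP.++⁻ (rights (take n z)) h



-- A mask m ∈ {true, false}^dg(f) marks the nodes of f kept in the trunk (true) or pruned
-- (false); it is admissible when every pruned node has its whole subtree pruned.
module Cuts where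

  open import Data.Nat using (suc; _+_; _≡ᵇ_)
  open import Data.Nat.Properties using (+-identityʳ; ≡ᵇ⇒≡)
  open import Data.Bool using (Bool; true; false; _∧_; T)
  open import Data.List using (List; []; _∷_; _++_; length; take; drop; null)
  open import Data.Vec using (Vec; []; _∷_)
  open import Data.Product using (_×_; _,_; proj₁; proj₂)
  open import Relation.Binary.PropositionalEquality
  open import Defs
  open TakeDrop
  open BoolFacts
  open CompatCheck using (dg-++)
  open TaggedWords using (#true; #false; allFalse; #true-take-drop; #false-take-drop; allFalse⇒#true≡0; allFalse⇒#false≡length)

  module _ {S : Signature} where

    mutual
      cutᵗ : Term S → List Bool → Term S × Forest S
      cutᵗ ⊥t m = ⊥t , []
      cutᵗ (node g us) [] = ⊥t , ((g , us) ∷ [])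
      cutᵗ (node g us) (false ∷ m) = ⊥t , ((g , us) ∷ [])
      cutᵗ (node g us) (true ∷ m) = node g (proj₁ (cutᶜ us m)) , proj₂ (cutᶜ us m)

      cutᶜ : ∀ {n} → Vec (Term S) n → List Bool → Vec (Term S) n × Forest S
      cutᶜ [] m = [] , []
      cutᶜ (t ∷ ts) m = (proj₁ (cutᵗ t (take (size t) m)) ∷ proj₁ (cutᶜ ts (drop (size t) m))) ,
                        (proj₂ (cutᵗ t (take (size t) m)) ++ proj₂ (cutᶜ ts (drop (size t) m)))

    mutual
      admissibleᵗ : Term S → List Bool → Bool
      admissibleᵗ ⊥t m = null m
      admissibleᵗ (node g us) [] = false
      admissibleᵗ (node g us) (true ∷ m) = admissibleᶜ us m
      admissibleᵗ (node g us) (false ∷ m) = allFalse m ∧ (length m ≡ᵇ sizes us)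

      admissibleᶜ : ∀ {n} → Vec (Term S) n → List Bool → Bool
      admissibleᶜ [] m = null m
      admissibleᶜ (t ∷ ts) m = admissibleᵗ t (take (size t) m) ∧ admissibleᶜ ts (drop (size t) m)

    asForest : Term S → Forest S
    asForest ⊥t = []
    asForest (node g us) = (g , us) ∷ []

    cut : Forest S → List Bool → Forest S × Forest S
    cut [] m = [] , []
    cut ((g , us) ∷ f) m =
      (asForest (proj₁ (cutᵗ (node g us) (take (suc (sizes us)) m))) ++ proj₁ (cut f (drop (suc (sizes us)) m))) ,
      (proj₂ (cutᵗ (node g us) (take (suc (sizes us)) m)) ++ proj₂ (cut f (drop (suc (sizes us)) m)))

    admissible : Forest S → List Bool → Bool
    admissible [] m = null m
    admissible ((g , us) ∷ f) m =
      admissibleᵗ (node g us) (take (suc (sizes us)) m) ∧ admissible f (drop (suc (sizes us)) m)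

    dg-asForest : ∀ t → dg (asForest t) ≡ size t
    dg-asForest ⊥t = refl
    dg-asForest (node g us) = +-identityʳ _

    mutual
      cutᵗ-sizes : ∀ t m → T (admissibleᵗ t m) → size (proj₁ (cutᵗ t m)) ≡ #true m × dg (proj₂ (cutᵗ t m)) ≡ #false m
      cutᵗ-sizes ⊥t [] h = refl , refl
      cutᵗ-sizes (node g us) (true ∷ m) h with cutᶜ-sizes us m h
      ... | trunk , pruned = cong suc trunk , pruned
      cutᵗ-sizes (node g us) (false ∷ m) h with T-∧⁻ {allFalse m} h
      ... | h₁ , h₂ = sym (allFalse⇒#true≡0 m h₁) ,
                      trans (+-identityʳ _) (cong suc (trans (sym (≡ᵇ⇒≡ _ _ h₂)) (sym (allFalse⇒#false≡length m h₁))))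

      cutᶜ-sizes : ∀ {n} (us : Vec (Term S) n) m → T (admissibleᶜ us m) →
                   sizes (proj₁ (cutᶜ us m)) ≡ #true m × dg (proj₂ (cutᶜ us m)) ≡ #false m
      cutᶜ-sizes [] [] h = refl , refl
      cutᶜ-sizes (t ∷ ts) m h with T-∧⁻ {admissibleᵗ t (take (size t) m)} h
      ... | h₁ , h₂ with cutᵗ-sizes t (take (size t) m) h₁ | cutᶜ-sizes ts (drop (size t) m) h₂
      ... | trunk₁ , pruned₁ | trunk₂ , pruned₂ =
        trans (cong₂ _+_ trunk₁ trunk₂) (sym (#true-take-drop (size t) m)) ,
        trans (dg-++ (proj₂ (cutᵗ t (take (size t) m))) _)
          (trans (cong₂ _+_ pruned₁ pruned₂) (sym (#false-take-drop (size t) m)))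

    cut-sizes : ∀ f m → T (admissible f m) → dg (proj₁ (cut f m)) ≡ #true m × dg (proj₂ (cut f m)) ≡ #false m
    cut-sizes [] [] h = refl , refl
    cut-sizes ((g , us) ∷ f) m h with T-∧⁻ {admissibleᵗ (node g us) (take (suc (sizes us)) m)} h
    ... | h₁ , h₂ with cutᵗ-sizes (node g us) (take (suc (sizes us)) m) h₁ | cut-sizes f (drop (suc (sizes us)) m) h₂
    ... | trunk₁ , pruned₁ | trunk₂ , pruned₂ =
      trans (dg-++ (asForest (proj₁ (cutᵗ (node g us) (take (suc (sizes us)) m)))) _)
        (trans (cong₂ _+_ (trans (dg-asForest _) trunk₁) trunk₂) (sym (#true-take-drop (suc (sizes us)) m))) ,
      trans (dg-++ (proj₂ (cutᵗ (node g us) (take (suc (sizes us)) m))) _)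
        (trans (cong₂ _+_ pruned₁ pruned₂) (sym (#false-take-drop (suc (sizes us)) m)))

    mutual
      admissibleᵗ-length : ∀ (t : Term S) m → T (admissibleᵗ t m) → length m ≡ size t
      admissibleᵗ-length ⊥t [] h = refl
      admissibleᵗ-length (node g us) (true ∷ m) h = cong suc (admissibleᶜ-length us m h)
      admissibleᵗ-length (node g us) (false ∷ m) h = cong suc (≡ᵇ⇒≡ _ _ (proj₂ (T-∧⁻ {allFalse m} h)))

      admissibleᶜ-length : ∀ {n} (us : Vec (Term S) n) m → T (admissibleᶜ us m) → length m ≡ sizes us
      admissibleᶜ-length [] [] h = refl
      admissibleᶜ-length (t ∷ ts) m h with T-∧⁻ {admissibleᵗ t (take (size t) m)} h
      ... | h₁ , h₂ = trans (length-take+drop (size t) m) (cong₂ _+_ (admissibleᵗ-length t _ h₁) (admissibleᶜ-length ts _ h₂))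

    admissible-length : ∀ (f : Forest S) m → T (admissible f m) → length m ≡ dg f
    admissible-length [] [] h = refl
    admissible-length ((g , us) ∷ f) m h with T-∧⁻ {admissibleᵗ (node g us) (take (suc (sizes us)) m)} h
    ... | h₁ , h₂ = trans (length-take+drop (suc (sizes us)) m)
                      (cong₂ _+_ (admissibleᵗ-length (node g us) (take (suc (sizes us)) m) h₁) (admissible-length f _ h₂))


-- Every letter of the left word being below every letter of the right word, an
-- increasing labelling of f by the shuffle tags its nodes so that the descendants of a
-- right-tagged node are right-tagged: the right-tagged nodes are the pruned part of an
-- admissible cut, and the labelling restricts to increasing labellings of both parts.
module CutCompat where

  open import Data.Nat using (suc; _<_; _<ᵇ_)
  open import Data.Nat.Properties using (<-asym; <-trans; <ᵇ⇒<; <⇒<ᵇ)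
  open import Data.Bool using (true; false; _∧_; T)
  open import Data.Unit using (tt)
  open import Data.Sum using (inj₁; inj₂)
  open import Data.Maybe using (just; nothing)
  open import Data.List using (List; []; _∷_; take; drop)
  open import Data.Vec using (Vec; []; _∷_)
  open import Data.List.Relation.Unary.All using (All; []; _∷_)
  import Data.List.Relation.Unary.All as All
  import Data.List.Relation.Unary.All.Properties as AP
  open import Data.Product using (_,_; proj₁; proj₂)
  open import Data.Empty using (⊥-elim)
  open import Relation.Nullary using (¬_)
  open import Relation.Binary.PropositionalEquality
  open import Defs
  open BoolFacts
  open CompatCheck
  open TaggedWords
  open Cuts

  above-rights : ∀ β y z → RightsAbove β (inj₂ y ∷ z) → above β y ≡ true
  above-rights nothing y z _ = refl
  above-rights (just x) y z (x<y ∷ _) = T⇒≡true (<⇒<ᵇ x<y)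

  module _ {S : Signature} where

    mutual
      termCompat-lefts≡[] : ∀ y (t : Term S) z → All (_< y) (lefts z) →
                            T (termCompat (just y) t (erase z)) → lefts z ≡ []
      termCompat-lefts≡[] y ⊥t z lefts<y h rewrite null-erase⇒[] z h = refl
      termCompat-lefts≡[] y (node g us) (inj₁ x ∷ z) (x<y ∷ _) h =
        ⊥-elim (<-asym x<y (<ᵇ⇒< y x (proj₁ (T-∧⁻ {y <ᵇ x} h))))
      termCompat-lefts≡[] y (node g us) (inj₂ y′ ∷ z) lefts<y h with T-∧⁻ {y <ᵇ y′} h
      ... | y<y′ , h′ = childrenCompat-lefts≡[] y′ us z (All.map (λ x<y → <-trans x<y (<ᵇ⇒< y y′ y<y′)) lefts<y) h′

      childrenCompat-lefts≡[] : ∀ {n} y (us : Vec (Term S) n) z → All (_< y) (lefts z) →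
                                T (childrenCompat y us (erase z)) → lefts z ≡ []
      childrenCompat-lefts≡[] y [] z lefts<y h rewrite null-erase⇒[] z h = refl
      childrenCompat-lefts≡[] y (t ∷ ts) z lefts<y h with T-∧⁻ {termCompat (just y) t (take (size t) (erase z))} h
      ... | h₁ , h₂ rewrite take-erase (size t) z | drop-erase (size t) z | lefts-take-drop (size t) z
          with AP.++⁻ (lefts (take (size t) z)) lefts<y
      ... | lefts<y₁ , lefts<y₂ rewrite termCompat-lefts≡[] y t (take (size t) z) lefts<y₁ h₁
                                      | childrenCompat-lefts≡[] y ts (drop (size t) z) lefts<y₂ h₂ = refl

    cutᵗ-blocks : ∀ (t : Term S) n z → T (admissibleᵗ t (mask (take n z))) →
                  BlockSplit n z (size (proj₁ (cutᵗ t (mask (take n z))))) (dg (proj₂ (cutᵗ t (mask (take n z)))))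
    cutᵗ-blocks t n z adm with trunk , pruned ← cutᵗ-sizes t (mask (take n z)) adm =
      blockSplit n z (trans trunk (#true-mask (take n z))) (trans pruned (#false-mask (take n z)))

    forestCompat-asForest : ∀ (t : Term S) w → forestCompat (asForest t) w ≡ termCompat nothing t w
    forestCompat-asForest ⊥t w = refl
    forestCompat-asForest (node g us) w = sym (termCompat-prefix nothing (node g us) w)

    mutual
      termCompat-erase : ∀ β (t : Term S) z → LeftsBelowRights z → RightsAbove β z →
        termCompat β t (erase z) ≡
        (admissibleᵗ t (mask z) ∧ (termCompat β (proj₁ (cutᵗ t (mask z))) (lefts z) ∧ forestCompat (proj₂ (cutᵗ t (mask z))) (rights z)))
      termCompat-erase β ⊥t z lbr ra = null-erase z
      termCompat-erase β (node g us) [] lbr ra = refl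
      termCompat-erase β (node g us) (inj₁ x ∷ z) (x<rights ∷ lbr) ra
        rewrite childrenCompat-erase x us z lbr x<rights = ∧-shuffle₄ (above β x) (admissibleᶜ us (mask z)) _ _
      termCompat-erase β (node g us) (inj₂ y ∷ z) lbr ra rewrite above-rights β y z ra with lefts z in eq
      ... | [] rewrite allFalse-mask z | eq | lefts≡[]⇒erase≡rights z eq | lefts≡[]⇒length-mask z eq =
            childrenCompat-prefix y us (rights z)
      ... | l ∷ ls rewrite allFalse-mask z | eq =
            ¬T⇒≡false (λ h → []≢∷ (trans (sym (childrenCompat-lefts≡[] y us z lefts<y h)) eq))
        where
        lefts<y : All (_< y) (lefts z)
        lefts<y = subst (All (_< y)) (sym eq) (All.map (λ { (l<y ∷ _) → l<y }) lbr)
        []≢∷ : ¬ [] ≡ l ∷ ls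
        []≢∷ ()

      childrenCompat-erase : ∀ {n} x (us : Vec (Term S) n) z → LeftsBelowRights z → All (x <_) (rights z) →
        childrenCompat x us (erase z) ≡
        (admissibleᶜ us (mask z) ∧ (childrenCompat x (proj₁ (cutᶜ us (mask z))) (lefts z) ∧ forestCompat (proj₂ (cutᶜ us (mask z))) (rights z)))
      childrenCompat-erase x [] z lbr x<rights = null-erase z
      childrenCompat-erase x (t ∷ ts) z lbr x<rights
        rewrite take-erase (size t) z | drop-erase (size t) z | take-mask (size t) z | drop-mask (size t) z
              | termCompat-erase (just x) t (take (size t) z) (proj₁ (LeftsBelowRights-take-drop (size t) z lbr))
                  (proj₁ (RightsAbove-take-drop (just x) (size t) z x<rights))
              | childrenCompat-erase x ts (drop (size t) z) (proj₂ (LeftsBelowRights-take-drop (size t) z lbr))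
                  (proj₂ (RightsAbove-take-drop (just x) (size t) z x<rights))
        with admissibleᵗ t (mask (take (size t) z)) in eq
      ... | false = refl
      ... | true
        with tl , dl , tr , dr ← cutᵗ-blocks t (size t) z (subst T (sym eq) tt)
        rewrite forestCompat-++ (proj₂ (cutᵗ t (mask (take (size t) z)))) (proj₂ (cutᶜ ts (mask (drop (size t) z)))) (rights z)
              | tl | dl | tr | dr
        = ∧-shuffle₅ (termCompat (just x) (proj₁ (cutᵗ t (mask (take (size t) z)))) (lefts (take (size t) z)))
                     (forestCompat (proj₂ (cutᵗ t (mask (take (size t) z)))) (rights (take (size t) z)))
                     (admissibleᶜ ts (mask (drop (size t) z)))
                     (childrenCompat x (proj₁ (cutᶜ ts (mask (drop (size t) z)))) (lefts (drop (size t) z)))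
                     (forestCompat (proj₂ (cutᶜ ts (mask (drop (size t) z)))) (rights (drop (size t) z)))

    forestCompat-erase : ∀ (f : Forest S) z → LeftsBelowRights z →
      forestCompat f (erase z) ≡
      (admissible f (mask z) ∧ (forestCompat (proj₁ (cut f (mask z))) (lefts z) ∧ forestCompat (proj₂ (cut f (mask z))) (rights z)))
    forestCompat-erase [] z lbr = null-erase z
    forestCompat-erase ((g , us) ∷ f) z lbr
        rewrite take-erase (suc (sizes us)) z | drop-erase (suc (sizes us)) z
              | take-mask (suc (sizes us)) z | drop-mask (suc (sizes us)) z
              | termCompat-erase nothing (node g us) (take (suc (sizes us)) z)
                  (proj₁ (LeftsBelowRights-take-drop (suc (sizes us)) z lbr)) tt
              | forestCompat-erase f (drop (suc (sizes us)) z) (proj₂ (LeftsBelowRights-take-drop (suc (sizes us)) z lbr))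
        with admissibleᵗ (node g us) (mask (take (suc (sizes us)) z)) in eq
    ... | false = refl
    ... | true
        with tl , dl , tr , dr ← cutᵗ-blocks (node g us) (suc (sizes us)) z (subst T (sym eq) tt)
        rewrite forestCompat-++ (asForest (proj₁ (cutᵗ (node g us) (mask (take (suc (sizes us)) z)))))
                                (proj₁ (cut f (mask (drop (suc (sizes us)) z)))) (lefts z)
              | forestCompat-++ (proj₂ (cutᵗ (node g us) (mask (take (suc (sizes us)) z))))
                                (proj₂ (cut f (mask (drop (suc (sizes us)) z)))) (rights z)
              | dg-asForest (proj₁ (cutᵗ (node g us) (mask (take (suc (sizes us)) z))))
              | tl | dl | tr | dr
              | forestCompat-asForest (proj₁ (cutᵗ (node g us) (mask (take (suc (sizes us)) z)))) (lefts (take (suc (sizes us)) z))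
        = ∧-shuffle₅ (termCompat nothing (proj₁ (cutᵗ (node g us) (mask (take (suc (sizes us)) z)))) (lefts (take (suc (sizes us)) z)))
                     (forestCompat (proj₂ (cutᵗ (node g us) (mask (take (suc (sizes us)) z)))) (rights (take (suc (sizes us)) z)))
                     (admissible f (mask (drop (suc (sizes us)) z)))
                     (forestCompat (proj₁ (cut f (mask (drop (suc (sizes us)) z)))) (lefts (drop (suc (sizes us)) z)))
                     (forestCompat (proj₂ (cut f (mask (drop (suc (sizes us)) z)))) (rights (drop (suc (sizes us)) z)))


module OrderIso where

  open import Data.Nat using (ℕ; zero; suc; _+_; _<_)
  open import Data.Nat.Properties using (+-monoʳ-<; +-cancelˡ-<)
  open import Data.Maybe using (just; nothing)
  import Data.Maybe as Maybe
  open import Data.List using ([]; _∷_; map; length)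
  open import Data.List.Properties using (length-map)
  open import Data.List.Membership.Propositional using (_∈_)
  open import Data.List.Relation.Unary.Any using (here; there)
  import Data.List.Relation.Unary.All as All
  open import Data.Product using (_×_; _,_; proj₁; proj₂)
  open import Relation.Nullary using (does)
  open import Relation.Binary.PropositionalEquality
  open import Function using (_∘_; _⇔_; mk⇔; id; Equivalence)
  open import Defs
  open BoolFacts using (does-cong)
  open Packing using (rank; rank-<; rank-reflects-<)

  OrderIso : Word → Word → Set
  OrderIso w v = length w ≡ length v × (∀ i j → ltM (nth w i) (nth w j) ⇔ ltM (nth v i) (nth v j))

  OrderIso-sym : ∀ {w v} → OrderIso w v → OrderIso v w
  OrderIso-sym (len , ord) = sym len , λ i j → mk⇔ (Equivalence.from (ord i j)) (Equivalence.to (ord i j))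

  OrderIso-trans : ∀ {w v u} → OrderIso w v → OrderIso v u → OrderIso w u
  OrderIso-trans (len , ord) (len′ , ord′) =
    trans len len′ , λ i j → mk⇔ (Equivalence.to (ord′ i j) ∘ Equivalence.to (ord i j))
                                 (Equivalence.from (ord i j) ∘ Equivalence.from (ord′ i j))

  Compat-OrderIso : ∀ {S : Signature} (f : Forest S) {w v} → OrderIso w v → Compat f w → Compat f v
  Compat-OrderIso f (len , ord) (lenw , increasing) =
    trans (sym len) lenw , All.map (λ {e} → Equivalence.to (ord (proj₁ e) (proj₂ e))) increasing

  does-Compat?-OrderIso : ∀ {S : Signature} (f : Forest S) {w v} → OrderIso w v → does (Compat? f w) ≡ does (Compat? f v)
  does-Compat?-OrderIso f {w} {v} w≅v =
    does-cong (Compat? f w) (Compat? f v) (Compat-OrderIso f {w} {v} w≅v) (Compat-OrderIso f {v} {w} (OrderIso-sym {w} {v} w≅v))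

  nth-map : ∀ (g : ℕ → ℕ) w i → nth (map g w) i ≡ Maybe.map g (nth w i)
  nth-map g [] i = refl
  nth-map g (x ∷ w) zero = refl
  nth-map g (x ∷ w) (suc i) = nth-map g w i

  nth⇒∈ : ∀ w i {a} → nth w i ≡ just a → a ∈ w
  nth⇒∈ (x ∷ w) zero refl = here refl
  nth⇒∈ (x ∷ w) (suc i) e = there (nth⇒∈ w i e)

  OrderIso-map : ∀ (g : ℕ → ℕ) w → (∀ {a b} → a ∈ w → b ∈ w → a < b ⇔ g a < g b) → OrderIso w (map g w)
  OrderIso-map g w g-mono = sym (length-map g w) , ord
    where
    ord : ∀ i j → ltM (nth w i) (nth w j) ⇔ ltM (nth (map g w) i) (nth (map g w) j)
    ord i j rewrite nth-map g w i | nth-map g w j with nth w i in ei | nth w j in ej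
    ... | just a | just b = g-mono (nth⇒∈ w i ei) (nth⇒∈ w j ej)
    ... | just a | nothing = mk⇔ id id
    ... | nothing | just b = mk⇔ id id
    ... | nothing | nothing = mk⇔ id id

  OrderIso-pck : ∀ w → OrderIso w (pck w)
  OrderIso-pck w = OrderIso-map (rank w) w (λ a∈ b∈ → mk⇔ (λ lt → rank-< w lt b∈) (rank-reflects-< w b∈))

  OrderIso-shift : ∀ K w → OrderIso w (map (K +_) w)
  OrderIso-shift K w = OrderIso-map (K +_) w (λ _ _ → mk⇔ (+-monoʳ-< K) (+-cancelˡ-< K _ _))


module Shuffles where

  open import Data.Nat using (ℕ; zero; suc; _+_; _∸_; _≤_; _<_; _≤?_)
  open import Data.Nat.Properties
  open import Data.Bool using (Bool; true; false)
  open import Data.Sum using (inj₁; inj₂)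
  open import Data.List using (List; []; _∷_; _++_; map; length)
  open import Data.List.Membership.Propositional using (_∈_)
  open import Data.List.Membership.Propositional.Properties using (∈-map⁺; ∈-map⁻; ∈-++⁻)
  open import Data.List.Relation.Unary.Any using (here)
  open import Data.List.Relation.Unary.All using (All; []; _∷_)
  import Data.List.Relation.Unary.All as All
  open import Data.Product using (_×_; _,_)
  open import Data.Empty using (⊥-elim)
  open import Relation.Nullary using (yes; no)
  open import Relation.Binary.PropositionalEquality
  open import Defs using (maxW)
  open Packing
  open TaggedWords

  shuffles : List ℕ → List ℕ → List Tagged
  shuffles [] c = map inj₂ c ∷ []
  shuffles (x ∷ a) [] = map inj₁ (x ∷ a) ∷ []
  shuffles (x ∷ a) (y ∷ c) = map (inj₁ x ∷_) (shuffles a (y ∷ c)) ++ map (inj₂ y ∷_) (shuffles (x ∷ a) c)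

  allMasks : ℕ → List (List Bool)
  allMasks zero = [] ∷ []
  allMasks (suc n) = map (true ∷_) (allMasks n) ++ map (false ∷_) (allMasks n)

  shuffles-lefts-rights : ∀ a c {z} → z ∈ shuffles a c → lefts z ≡ a × rights z ≡ c
  shuffles-lefts-rights [] c (here refl) = lefts-inj₂ c , rights-inj₂ c
  shuffles-lefts-rights (x ∷ a) [] (here refl) = cong (x ∷_) (lefts-inj₁ a) , rights-inj₁ a
  shuffles-lefts-rights (x ∷ a) (y ∷ c) z∈ with ∈-++⁻ (map (inj₁ x ∷_) (shuffles a (y ∷ c))) z∈
  ... | inj₁ z∈₁ with ∈-map⁻ (inj₁ x ∷_) z∈₁
  ...   | z′ , z′∈ , refl with shuffles-lefts-rights a (y ∷ c) z′∈
  ...     | lefts≡ , rights≡ = cong (x ∷_) lefts≡ , rights≡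
  shuffles-lefts-rights (x ∷ a) (y ∷ c) z∈ | inj₂ z∈₂ with ∈-map⁻ (inj₂ y ∷_) z∈₂
  ...   | z′ , z′∈ , refl with shuffles-lefts-rights (x ∷ a) c z′∈
  ...     | lefts≡ , rights≡ = lefts≡ , cong (y ∷_) rights≡

  erase-gapless : ∀ a v z → Gapless a → Gapless v → lefts z ≡ a → rights z ≡ map (maxW a +_) v → Gapless (erase z)
  erase-gapless a v z (a-pos , a-down) (v-pos , v-down) lefts≡a rights≡K+v = All.tabulate pos , down
    where
    K = maxW a
    inA : ∀ {x} → x ∈ lefts z → x ∈ a
    inA = subst (_ ∈_) lefts≡a
    inK+v : ∀ {x} → x ∈ rights z → x ∈ map (K +_) v
    inK+v = subst (_ ∈_) rights≡K+v
    pos : ∀ {x} → x ∈ erase z → 1 ≤ x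
    pos x∈ with ∈-erase⁻ z x∈
    ... | inj₁ x∈l = All.lookup a-pos (inA x∈l)
    ... | inj₂ x∈r with ∈-map⁻ (K +_) (inK+v x∈r)
    ...   | y , y∈ , refl = ≤-trans (All.lookup v-pos y∈) (m≤n+m y K)
    down : ∀ {b y} → 1 ≤ b → y ∈ erase z → b ≤ y → b ∈ erase z
    down {b} {y} 1≤b y∈ b≤y with b ≤? K
    ... | yes b≤K = ∈-lefts⇒∈-erase z (subst (b ∈_) (sym lefts≡a) (a-down 1≤b (maxW-∈ a (≤-trans 1≤b b≤K)) b≤K))
    ... | no b≰K with ∈-erase⁻ z y∈
    ...   | inj₁ y∈l = ⊥-elim (b≰K (≤-trans b≤y (≤-maxW a (inA y∈l))))
    ...   | inj₂ y∈r with ∈-map⁻ (K +_) (inK+v y∈r)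
    ...     | y′ , y′∈ , refl =
      ∈-rights⇒∈-erase z (subst (b ∈_) (sym rights≡K+v) (subst (_∈ map (K +_) v) (m+[n∸m]≡n K≤b)
        (∈-map⁺ (K +_) (v-down (m<n⇒0<n∸m (≰⇒> b≰K)) y′∈ (subst (b ∸ K ≤_) (m+n∸m≡n K y′) (∸-monoˡ-≤ K b≤y))))))
      where K≤b = <⇒≤ (≰⇒> b≰K)

  shuffles-LeftsBelowRights : ∀ K a c {z} → All (_≤ K) a → All (K <_) c → z ∈ shuffles a c → LeftsBelowRights z
  shuffles-LeftsBelowRights K a c a≤K K<c z∈ with shuffles-lefts-rights a c z∈
  ... | lefts≡a , rights≡c rewrite lefts≡a | rights≡c = All.map (λ x≤K → All.map (≤-<-trans x≤K) K<c) a≤K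

  ∈-allMasks⇒length : ∀ n {m} → m ∈ allMasks n → length m ≡ n
  ∈-allMasks⇒length zero (here refl) = refl
  ∈-allMasks⇒length (suc n) {m} m∈ with ∈-++⁻ (map (true ∷_) (allMasks n)) m∈
  ... | inj₁ m∈₁ with ∈-map⁻ (true ∷_) m∈₁
  ...   | m′ , m′∈ , refl = cong suc (∈-allMasks⇒length n m′∈)
  ∈-allMasks⇒length (suc n) {m} m∈ | inj₂ m∈₂ with ∈-map⁻ (false ∷_) m∈₂
  ...   | m′ , m′∈ , refl = cong suc (∈-allMasks⇒length n m′∈)


module FiniteSums {c ℓ : Level} (K : Char0Field c ℓ) where

  open import Data.Nat as ℕ using (ℕ)
  import Data.Nat.Properties as ℕP
  open import Data.Bool using (Bool; true; false; _∧_; T; if_then_else_)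
  open import Data.List using (List; []; _∷_; _++_; map; filter; concatMap)
  import Data.List.Properties as LP
  open import Data.List.Membership.Propositional using (_∈_; _∉_)
  open import Data.List.Relation.Unary.Any using (here; there)
  open import Data.List.Relation.Unary.All.Properties using (All¬⇒¬Any)
  open import Data.List.Relation.Unary.AllPairs using (_∷_)
  open import Data.List.Relation.Unary.Unique.Propositional using (Unique)
  open import Data.Empty using (⊥-elim)
  open import Relation.Nullary using (yes; no; does)
  open import Relation.Unary using (Pred; Decidable)
  import Relation.Binary.PropositionalEquality as P
  open P using (_≡_)
  open import Function using (_∘_)
  open BoolFacts using (≡ᵇ-refl)

  open Char0Field K
  open Poly K
  open import Relation.Binary.Reasoning.Setoid setoid

  ⟦_⟧ : Bool → Carrier
  ⟦ b ⟧ = if b then 1# else 0#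

  ⟦∧⟧ : ∀ a b → ⟦ a ∧ b ⟧ ≈ ⟦ a ⟧ * ⟦ b ⟧
  ⟦∧⟧ true b = sym (*-identityˡ _)
  ⟦∧⟧ false b = sym (zeroˡ _)

  Σ-++ : ∀ xs ys → Σ[ xs ++ ys ] ≈ Σ[ xs ] + Σ[ ys ]
  Σ-++ [] ys = sym (+-identityˡ _)
  Σ-++ (x ∷ xs) ys = trans (+-congˡ (Σ-++ xs ys)) (sym (+-assoc _ _ _))

  module _ {la : Level} {A : Set la} where
    Σ-cong : ∀ (xs : List A) {f g : A → Carrier} → (∀ {x} → x ∈ xs → f x ≈ g x) → Σ[ map f xs ] ≈ Σ[ map g xs ]
    Σ-cong [] h = refl
    Σ-cong (x ∷ xs) h = +-cong (h (here P.refl)) (Σ-cong xs (h ∘ there))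

    Σ-cong′ : ∀ (xs : List A) {f g : A → Carrier} → (∀ x → f x ≈ g x) → Σ[ map f xs ] ≈ Σ[ map g xs ]
    Σ-cong′ xs h = Σ-cong xs (λ {x} _ → h x)

    Σ-*ˡ : ∀ a (xs : List A) f → a * Σ[ map f xs ] ≈ Σ[ map (λ x → a * f x) xs ]
    Σ-*ˡ a [] f = zeroʳ a
    Σ-*ˡ a (x ∷ xs) f = trans (distribˡ a _ _) (+-congˡ (Σ-*ˡ a xs f))

    Σ-*ʳ : ∀ a (xs : List A) f → Σ[ map f xs ] * a ≈ Σ[ map (λ x → f x * a) xs ]
    Σ-*ʳ a [] f = zeroˡ a
    Σ-*ʳ a (x ∷ xs) f = trans (distribʳ a _ _) (+-congˡ (Σ-*ʳ a xs f))

    Σ-+ : ∀ (xs : List A) f g → Σ[ map (λ x → f x + g x) xs ] ≈ Σ[ map f xs ] + Σ[ map g xs ]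
    Σ-+ [] f g = sym (+-identityˡ _)
    Σ-+ (x ∷ xs) f g = begin
        (f x + g x) + Σ[ map (λ x → f x + g x) xs ]     ≈⟨ +-congˡ (Σ-+ xs f g) ⟩
        (f x + g x) + (Σ[ map f xs ] + Σ[ map g xs ])  ≈⟨ +-assoc _ _ _ ⟩
        f x + (g x + (Σ[ map f xs ] + Σ[ map g xs ]))  ≈⟨ +-congˡ (sym (+-assoc _ _ _)) ⟩
        f x + ((g x + Σ[ map f xs ]) + Σ[ map g xs ])  ≈⟨ +-congˡ (+-congʳ (+-comm _ _)) ⟩
        f x + ((Σ[ map f xs ] + g x) + Σ[ map g xs ])  ≈⟨ +-congˡ (+-assoc _ _ _) ⟩
        f x + (Σ[ map f xs ] + (g x + Σ[ map g xs ]))  ≈⟨ sym (+-assoc _ _ _) ⟩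
        (f x + Σ[ map f xs ]) + (g x + Σ[ map g xs ])  ∎

    Σ-map++ : ∀ (f : A → Carrier) xs ys → Σ[ map f (xs ++ ys) ] ≈ Σ[ map f xs ] + Σ[ map f ys ]
    Σ-map++ f xs ys = trans (reflexive (P.cong Σ[_] (LP.map-++ f xs ys))) (Σ-++ (map f xs) (map f ys))

    Σ-0 : ∀ (xs : List A) f → (∀ {x} → x ∈ xs → f x ≈ 0#) → Σ[ map f xs ] ≈ 0#
    Σ-0 [] f h = refl
    Σ-0 (x ∷ xs) f h = trans (+-cong (h (here P.refl)) (Σ-0 xs f (h ∘ there))) (+-identityˡ 0#)

    Σ-map : ∀ {lb} {B : Set lb} (xs : List B) (g : B → A) (f : A → Carrier) → Σ[ map f (map g xs) ] ≡ Σ[ map (f ∘ g) xs ]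
    Σ-map xs g f = P.cong Σ[_] (P.sym (LP.map-∘ xs))

    Σ-concatMap : ∀ {lb} {B : Set lb} (xs : List B) (g : B → List A) (f : A → Carrier) →
                  Σ[ map f (concatMap g xs) ] ≈ Σ[ map (λ x → Σ[ map f (g x) ]) xs ]
    Σ-concatMap [] g f = refl
    Σ-concatMap (x ∷ xs) g f = trans (reflexive (P.cong Σ[_] (LP.map-++ f (g x) (concatMap g xs))))
                                  (trans (Σ-++ (map f (g x)) (map f (concatMap g xs)))
                                     (+-congˡ (Σ-concatMap xs g f)))

    Σ-filter : ∀ {P : Pred A Level.zero} (P? : Decidable P) (xs : List A) f →
               Σ[ map f (filter P? xs) ] ≈ Σ[ map (λ x → ⟦ does (P? x) ⟧ * f x) xs ]
    Σ-filter P? [] f = refl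
    Σ-filter P? (x ∷ xs) f with P? x
    ... | yes _ = +-cong (sym (*-identityˡ _)) (Σ-filter P? xs f)
    ... | no _ = trans (Σ-filter P? xs f) (trans (sym (+-identityˡ _)) (+-congʳ (sym (zeroˡ _))))

  module _ {la lb : Level} {A : Set la} {B : Set lb} where
    Σ-swap : ∀ (xs : List A) (ys : List B) (f : A → B → Carrier) →
             Σ[ map (λ x → Σ[ map (λ y → f x y) ys ]) xs ] ≈ Σ[ map (λ y → Σ[ map (λ x → f x y) xs ]) ys ]
    Σ-swap [] ys f = sym (Σ-0 ys _ (λ _ → refl))
    Σ-swap (x ∷ xs) ys f = trans (+-congˡ (Σ-swap xs ys f)) (sym (Σ-+ ys (λ y → f x y) _))

  Σ-⟦∧⟧ˡ : ∀ {la} {A : Set la} e (xs : List A) (g : A → Bool) →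
            Σ[ map (λ x → ⟦ e ∧ g x ⟧) xs ] ≈ ⟦ e ⟧ * Σ[ map (λ x → ⟦ g x ⟧) xs ]
  Σ-⟦∧⟧ˡ e xs g = trans (Σ-cong′ xs (λ x → ⟦∧⟧ e (g x))) (sym (Σ-*ˡ _ xs _))

  Σ-δ-∉ : ∀ (xs : List ℕ) k (g : ℕ → Carrier) → k ∉ xs →
         Σ[ map (λ x → ⟦ x ℕ.≡ᵇ k ⟧ * g x) xs ] ≈ 0#
  Σ-δ-∉ xs k g k∉ = Σ-0 xs _ f
    where
    f : ∀ {x} → x ∈ xs → ⟦ x ℕ.≡ᵇ k ⟧ * g x ≈ 0#
    f {x} x∈ with x ℕ.≡ᵇ k in eq
    ... | true = ⊥-elim (k∉ (P.subst (_∈ xs) (ℕP.≡ᵇ⇒≡ x k (P.subst T (P.sym eq) _)) x∈))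
    ... | false = zeroˡ _

  Σ-δ-∈ : ∀ (xs : List ℕ) k (g : ℕ → Carrier) → Unique xs → k ∈ xs →
         Σ[ map (λ x → ⟦ x ℕ.≡ᵇ k ⟧ * g x) xs ] ≈ g k
  Σ-δ-∈ (x ∷ xs) k g (x∉ ∷ u) (here P.refl) rewrite ≡ᵇ-refl x =
    trans (+-cong (*-identityˡ _) (Σ-δ-∉ xs x g (λ x∈ → All¬⇒¬Any x∉ x∈))) (+-identityʳ _)
  Σ-δ-∈ (x ∷ xs) k g (x∉ ∷ u) (there k∈) with x ℕ.≡ᵇ k in eq
  ... | true = ⊥-elim (All¬⇒¬Any x∉ (P.subst (_∈ xs) (P.sym (ℕP.≡ᵇ⇒≡ x k (P.subst T (P.sym eq) _))) k∈))
  ... | false = trans (+-cong (zeroˡ _) (Σ-δ-∈ xs k g u k∈)) (+-identityˡ _)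


module Expansion {c ℓ : Level} (K : Char0Field c ℓ) where

  open import Data.Nat using (ℕ; zero; suc; _≤_; _<ᵇ_; _≡ᵇ_)
  import Data.Nat.Properties as ℕP
  open import Data.Bool using (Bool; true; false; _∧_; T)
  open import Data.List using (List; []; _∷_; map; filter; length; upTo)
  import Data.List.Properties as LP
  open import Data.List.Membership.Propositional using (_∈_)
  open import Data.List.Membership.Propositional.Properties using (∈-map⁻; ∈-upTo⁺; ∈-upTo⁻)
  open import Data.List.Relation.Unary.All using (All; []; _∷_)
  import Data.List.Relation.Unary.All as All
  import Data.List.Relation.Unary.Unique.Propositional.Properties as UP
  open import Data.Product using (_×_; _,_; proj₂)
  open import Relation.Nullary using (yes; no; does; ¬_)
  open import Relation.Nullary.Decidable using (dec-true)
  import Relation.Binary.PropositionalEquality as P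
  open P using (_≡_)
  open import Function using (_∘_)

  open Char0Field K
  open Poly K
  open import Relation.Binary.Reasoning.Setoid setoid
  open BoolFacts
  open FiniteSums K
  open Packing using (pck-idem; rank-positive; rank-≤-length)
  open OrderIso
  open CompatCheck using (does-Compat?; forestCompat-length)
  open import Algebra.Properties.CommutativeSemigroup using (x∙yz≈z∙xy)

  ⟦≟W-∷⟧ : ∀ b y a v → ⟦ does ((b ∷ y) ≟W (a ∷ v)) ⟧ ≈ ⟦ b ≡ᵇ a ⟧ * ⟦ does (y ≟W v) ⟧
  ⟦≟W-∷⟧ b y a v = ⟦∧⟧ (b ≡ᵇ a) (does (y ≟W v))

  inWordsOver : ℕ → ℕ → Word → Bool
  inWordsOver m zero [] = true
  inWordsOver m zero (_ ∷ _) = false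
  inWordsOver m (suc d) [] = false
  inWordsOver m (suc d) (zero ∷ y) = false
  inWordsOver m (suc d) (suc b ∷ y) = (b <ᵇ m) ∧ inWordsOver m d y

  Σ-wordsOver-δ : ∀ m d y (g : Word → Carrier) →
    Σ[ map (λ u → ⟦ does (y ≟W u) ⟧ * g u) (wordsOver m d) ] ≈ ⟦ inWordsOver m d y ⟧ * g y
  Σ-wordsOver-δ m zero [] g = +-identityʳ _
  Σ-wordsOver-δ m zero (b ∷ y) g = trans (+-identityʳ _) (trans (zeroˡ _) (sym (zeroˡ _)))
  Σ-wordsOver-δ m (suc d) y g = trans (Σ-concatMap (map suc (upTo m)) (λ a → map (a ∷_) (wordsOver m d)) _)
                    (trans (reflexive (Σ-map (upTo m) suc _)) (byFirstLetter y))
    where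
    byFirstLetter : ∀ y → Σ[ map ((λ a → Σ[ map (λ u → ⟦ does (y ≟W u) ⟧ * g u) (map (a ∷_) (wordsOver m d)) ]) ∘ suc) (upTo m) ] ≈
                          ⟦ inWordsOver m (suc d) y ⟧ * g y
    byFirstLetter [] = trans (Σ-0 (upTo m) _ (λ {a} _ → trans (reflexive (Σ-map (wordsOver m d) (suc a ∷_) _))
                       (Σ-0 (wordsOver m d) _ (λ _ → zeroˡ _)))) (sym (zeroˡ _))
    byFirstLetter (b ∷ y′) = begin
        _ ≈⟨ Σ-cong′ (upTo m) (λ a → trans (reflexive (Σ-map (wordsOver m d) (suc a ∷_) _))
               (trans (Σ-cong′ (wordsOver m d) (λ v → trans (*-congʳ (⟦≟W-∷⟧ b y′ (suc a) v)) (*-assoc _ _ _)))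
                 (trans (sym (Σ-*ˡ _ (wordsOver m d) _))
                   (*-congˡ (Σ-wordsOver-δ m d y′ (λ v → g (suc a ∷ v))))))) ⟩
        Σ[ map (λ a → ⟦ b ≡ᵇ suc a ⟧ * (⟦ inWordsOver m d y′ ⟧ * g (suc a ∷ y′))) (upTo m) ] ≈⟨ firstLetter b ⟩
        ⟦ inWordsOver m (suc d) (b ∷ y′) ⟧ * g (b ∷ y′) ∎
      where
      firstLetter : ∀ b → Σ[ map (λ a → ⟦ b ≡ᵇ suc a ⟧ * (⟦ inWordsOver m d y′ ⟧ * g (suc a ∷ y′))) (upTo m) ] ≈
                          ⟦ inWordsOver m (suc d) (b ∷ y′) ⟧ * g (b ∷ y′)
      firstLetter zero = trans (Σ-0 (upTo m) _ (λ _ → zeroˡ _)) (sym (zeroˡ _))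
      firstLetter (suc b) with b ℕP.<? m
      ... | yes b<m rewrite T⇒≡true (ℕP.<⇒<ᵇ b<m) =
            trans (Σ-cong′ (upTo m) (λ a → reflexive (P.cong (λ z → ⟦ z ⟧ * (⟦ inWordsOver m d y′ ⟧ * g (suc a ∷ y′))) (≡ᵇ-sym b a))))
                  (Σ-δ-∈ (upTo m) b (λ a → ⟦ inWordsOver m d y′ ⟧ * g (suc a ∷ y′)) (UP.upTo⁺ m) (∈-upTo⁺ b<m))
      ... | no b≮m rewrite ¬T⇒≡false (λ h → b≮m (ℕP.<ᵇ⇒< b m h)) =
            trans (Σ-cong′ (upTo m) (λ a → reflexive (P.cong (λ z → ⟦ z ⟧ * (⟦ inWordsOver m d y′ ⟧ * g (suc a ∷ y′))) (≡ᵇ-sym b a))))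
                  (trans (Σ-δ-∉ (upTo m) b _ (λ b∈ → b≮m (∈-upTo⁻ b∈))) (sym (zeroˡ _)))

  inWordsOver-true : ∀ m d y → length y ≡ d → All (λ x → 1 ≤ x × x ≤ m) y → inWordsOver m d y ≡ true
  inWordsOver-true m zero [] e a = P.refl
  inWordsOver-true m (suc d) (suc b ∷ y) e ((_ , b<m) ∷ a) rewrite T⇒≡true (ℕP.<⇒<ᵇ b<m) = inWordsOver-true m d y (ℕP.suc-injective e) a
  inWordsOver-true m (suc d) (zero ∷ y) e ((() , _) ∷ a)

  inWordsOver-length : ∀ m d y → T (inWordsOver m d y) → length y ≡ d
  inWordsOver-length m zero [] _ = P.refl
  inWordsOver-length m (suc d) (suc b ∷ y) h = P.cong suc (inWordsOver-length m d y (proj₂ (T-∧⁻ {b <ᵇ m} h)))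

  inWordsOver-false : ∀ m d y → ¬ length y ≡ d → inWordsOver m d y ≡ false
  inWordsOver-false m d y ne = ¬T⇒≡false (λ h → ne (inWordsOver-length m d y h))

  pck-bounds : ∀ w {x} → x ∈ pck w → 1 ≤ x × x ≤ length w
  pck-bounds w x∈ with ∈-map⁻ (Packing.rank w) x∈
  ... | a , a∈ , P.refl = rank-positive w a∈ , rank-≤-length w a

  -- Only u = pck w contributes, and packing does not change compatibility.
  expansion : ∀ {S : Signature} (f : Forest S) (w : Word) →
              rE f w ≈ Σ[ map (λ u → [ Compat? f u ]? * M u w) (packedWords (dg f)) ]
  expansion f w = sym (begin
      Σ[ map (λ u → [ Compat? f u ]? * M u w) (filter (λ u → pck u ≟W u) (wordsOver d d)) ]
        ≈⟨ Σ-filter (λ u → pck u ≟W u) (wordsOver d d) _ ⟩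
      Σ[ map (λ u → ⟦ does (pck u ≟W u) ⟧ * (⟦ does (Compat? f u) ⟧ * ⟦ does (pck w ≟W u) ⟧)) (wordsOver d d) ]
        ≈⟨ Σ-cong′ (wordsOver d d) (λ u → x∙yz≈z∙xy *-commutativeSemigroup _ _ _) ⟩
      Σ[ map (λ u → ⟦ does (pck w ≟W u) ⟧ * (⟦ does (pck u ≟W u) ⟧ * ⟦ does (Compat? f u) ⟧)) (wordsOver d d) ]
        ≈⟨ Σ-wordsOver-δ d d (pck w) (λ u → ⟦ does (pck u ≟W u) ⟧ * ⟦ does (Compat? f u) ⟧) ⟩
      ⟦ inWordsOver d d (pck w) ⟧ * (⟦ does (pck (pck w) ≟W pck w) ⟧ * ⟦ does (Compat? f (pck w)) ⟧)
        ≈⟨ atPck ⟩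
      rE f w ∎)
    where
    d = dg f
    atPck : ⟦ inWordsOver d d (pck w) ⟧ * (⟦ does (pck (pck w) ≟W pck w) ⟧ * ⟦ does (Compat? f (pck w)) ⟧) ≈ rE f w
    atPck with length w ℕP.≟ d
    ... | yes e = begin
        ⟦ inWordsOver d d (pck w) ⟧ * (⟦ does (pck (pck w) ≟W pck w) ⟧ * ⟦ does (Compat? f (pck w)) ⟧)
          ≡⟨ P.cong₂ (λ a b → ⟦ a ⟧ * (⟦ b ⟧ * ⟦ does (Compat? f (pck w)) ⟧))
               (inWordsOver-true d d (pck w) (P.trans (LP.length-map _ w) e)
                          (All.tabulate (λ {x} x∈ → P.subst (λ n → 1 ≤ x × x ≤ n) e (pck-bounds w x∈))))
               (P.trans (P.cong (λ z → does (z ≟W pck w)) (pck-idem w)) (dec-true (pck w ≟W pck w) P.refl)) ⟩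
        1# * (1# * ⟦ does (Compat? f (pck w)) ⟧)
          ≈⟨ trans (*-identityˡ _) (*-identityˡ _) ⟩
        ⟦ does (Compat? f (pck w)) ⟧
          ≡⟨ P.cong ⟦_⟧ (P.sym (does-Compat?-OrderIso f {w} {pck w} (OrderIso-pck w))) ⟩
        rE f w ∎
    ... | no ne rewrite inWordsOver-false d d (pck w) (λ e → ne (P.trans (P.sym (LP.length-map _ w)) e))
                      | does-Compat? f w
                      | ¬T⇒≡false (λ h → ne (forestCompat-length f w h)) = zeroˡ _


module ShuffleSums {c ℓ : Level} (Kf : Char0Field c ℓ) where

  open import Data.Nat as ℕ using (ℕ; zero; suc; _≤_; _<_; _≡ᵇ_; _≤?_; _<?_)
  import Data.Nat.Properties as ℕP
  open import Data.Bool using (Bool; true; false; _∧_; T)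
  open import Data.Bool.Properties using (∧-assoc)
  open import Data.Sum using (inj₁; inj₂)
  open import Data.List using (List; []; _∷_; map; filter; length; replicate)
  import Data.List.Properties as LP
  open import Data.List.Relation.Unary.All using (All; []; _∷_)
  import Data.List.Relation.Unary.All as All
  open import Data.Product using (_×_; _,_; proj₁; proj₂)
  open import Relation.Nullary using (yes; no; does; Dec; ¬_)
  import Relation.Binary.PropositionalEquality as P
  open P using (_≡_)
  open import Function using (_∘_)

  open Char0Field Kf
  open Poly Kf
  open import Relation.Binary.Reasoning.Setoid setoid
  open FiniteSums Kf
  open BoolFacts
  open TaggedWords using (Tagged; erase; mask; #true; #false; erase-inj₁; erase-inj₂; mask-inj₁; mask-inj₂)
  open Shuffles
  open FilterDedup using (filter≡[]⇒none)

  filter-split-right : ∀ K c u → All (K <_) c → does (c ≟W u) ≡ (does (filter (_≤? K) u ≟W []) ∧ does (filter (K <?_) u ≟W c))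
  filter-split-right K c u K<c = T-ext to from
    where
    to : T (does (c ≟W u)) → T (does (filter (_≤? K) u ≟W []) ∧ does (filter (K <?_) u ≟W c))
    to h with ≟W-sound {c} {u} h
    ... | P.refl = T-∧⁺ (≟W-complete (LP.filter-none (_≤? K) (All.map ℕP.<⇒≱ K<c))) (≟W-complete (LP.filter-all (K <?_) K<c))
    from : T (does (filter (_≤? K) u ≟W []) ∧ does (filter (K <?_) u ≟W c)) → T (does (c ≟W u))
    from h with T-∧⁻ {does (filter (_≤? K) u ≟W [])} h
    ... | h₁ , h₂ = ≟W-complete (P.trans (P.sym (≟W-sound h₂))
                      (LP.filter-all (K <?_) (All.map ℕP.≰⇒> (filter≡[]⇒none (_≤? K) u (≟W-sound h₁)))))

  filter-split-left : ∀ K a u → All (_≤ K) a → does (a ≟W u) ≡ (does (filter (_≤? K) u ≟W a) ∧ does (filter (K <?_) u ≟W []))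
  filter-split-left K a u a≤K = T-ext to from
    where
    to : T (does (a ≟W u)) → T (does (filter (_≤? K) u ≟W a) ∧ does (filter (K <?_) u ≟W []))
    to h with ≟W-sound {a} {u} h
    ... | P.refl = T-∧⁺ (≟W-complete (LP.filter-all (_≤? K) a≤K)) (≟W-complete (LP.filter-none (K <?_) (All.map ℕP.≤⇒≯ a≤K)))
    from : T (does (filter (_≤? K) u ≟W a) ∧ does (filter (K <?_) u ≟W [])) → T (does (a ≟W u))
    from h with T-∧⁻ {does (filter (_≤? K) u ≟W a)} h
    ... | h₁ , h₂ = ≟W-complete (P.trans (P.sym (≟W-sound h₁))
                      (LP.filter-all (_≤? K) (All.map ℕP.≮⇒≥ (filter≡[]⇒none (K <?_) u (≟W-sound h₂)))))

  Σ-shuffles-∷ : ∀ (g : Tagged → Carrier) x a y c →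
    Σ[ map g (shuffles (x ∷ a) (y ∷ c)) ] ≈
    Σ[ map (g ∘ (inj₁ x ∷_)) (shuffles a (y ∷ c)) ] + Σ[ map (g ∘ (inj₂ y ∷_)) (shuffles (x ∷ a) c) ]
  Σ-shuffles-∷ g x a y c =
    trans (Σ-map++ g (map (inj₁ x ∷_) (shuffles a (y ∷ c))) (map (inj₂ y ∷_) (shuffles (x ∷ a) c)))
          (+-cong (reflexive (Σ-map (shuffles a (y ∷ c)) (inj₁ x ∷_) g)) (reflexive (Σ-map (shuffles (x ∷ a) c) (inj₂ y ∷_) g)))

  -- Since a ≤ K < c, a shuffle of a and c is determined by its erasure.
  Σ-shuffles-≟ : ∀ K a c u → All (_≤ K) a → All (K <_) c →
    Σ[ map (λ z → ⟦ does (erase z ≟W u) ⟧) (shuffles a c) ] ≈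
    ⟦ does (filter (_≤? K) u ≟W a) ∧ does (filter (K <?_) u ≟W c) ⟧
  Σ-shuffles-≟ K [] c u a≤K K<c =
    trans (+-identityʳ _) (reflexive (P.cong ⟦_⟧ (P.trans (P.cong (λ w → does (w ≟W u)) (erase-inj₂ c)) (filter-split-right K c u K<c))))
  Σ-shuffles-≟ K (x ∷ a) [] u a≤K K<c =
    trans (+-identityʳ _) (reflexive (P.cong ⟦_⟧ (P.trans (P.cong (λ w → does (w ≟W u)) (erase-inj₁ (x ∷ a))) (filter-split-left K (x ∷ a) u a≤K))))
  Σ-shuffles-≟ K (x ∷ a) (y ∷ c) [] a≤K K<c =
    trans (Σ-shuffles-∷ _ x a y c)
      (trans (+-cong (Σ-0 (shuffles a (y ∷ c)) _ (λ _ → refl)) (Σ-0 (shuffles (x ∷ a) c) _ (λ _ → refl))) (+-identityʳ _))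
  Σ-shuffles-≟ K (x ∷ a) (y ∷ c) (b ∷ u) (x≤K ∷ a≤K) (K<y ∷ K<c) = begin
      Σ[ map (λ z → ⟦ does (erase z ≟W (b ∷ u)) ⟧) (shuffles (x ∷ a) (y ∷ c)) ]
        ≈⟨ Σ-shuffles-∷ _ x a y c ⟩
      Σ[ map (λ z → ⟦ (x ≡ᵇ b) ∧ does (erase z ≟W u) ⟧) (shuffles a (y ∷ c)) ] +
      Σ[ map (λ z → ⟦ (y ≡ᵇ b) ∧ does (erase z ≟W u) ⟧) (shuffles (x ∷ a) c) ]
        ≈⟨ +-cong (trans (Σ-⟦∧⟧ˡ (x ≡ᵇ b) (shuffles a (y ∷ c)) _) (*-congˡ (Σ-shuffles-≟ K a (y ∷ c) u a≤K (K<y ∷ K<c))))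
                  (trans (Σ-⟦∧⟧ˡ (y ≡ᵇ b) (shuffles (x ∷ a) c) _) (*-congˡ (Σ-shuffles-≟ K (x ∷ a) c u (x≤K ∷ a≤K) K<c))) ⟩
      ⟦ x ≡ᵇ b ⟧ * ⟦ does (filter (_≤? K) u ≟W a) ∧ does (filter (K <?_) u ≟W (y ∷ c)) ⟧ +
      ⟦ y ≡ᵇ b ⟧ * ⟦ does (filter (_≤? K) u ≟W (x ∷ a)) ∧ does (filter (K <?_) u ≟W c) ⟧
        ≈⟨ firstLetter ⟩
      ⟦ does (filter (_≤? K) (b ∷ u) ≟W (x ∷ a)) ∧ does (filter (K <?_) (b ∷ u) ≟W (y ∷ c)) ⟧ ∎
    where
    firstLetter : ⟦ x ≡ᵇ b ⟧ * ⟦ does (filter (_≤? K) u ≟W a) ∧ does (filter (K <?_) u ≟W (y ∷ c)) ⟧ +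
                  ⟦ y ≡ᵇ b ⟧ * ⟦ does (filter (_≤? K) u ≟W (x ∷ a)) ∧ does (filter (K <?_) u ≟W c) ⟧ ≈
                  ⟦ does (filter (_≤? K) (b ∷ u) ≟W (x ∷ a)) ∧ does (filter (K <?_) (b ∷ u) ≟W (y ∷ c)) ⟧
    firstLetter with b ≤? K
    ... | yes b≤K rewrite LP.filter-accept (_≤? K) {b} {u} b≤K | LP.filter-reject (K <?_) {b} {u} (ℕP.≤⇒≯ b≤K)
                        | ≢⇒≡ᵇ≡false y b (λ e → ℕP.<⇒≱ K<y (P.subst (_≤ K) (P.sym e) b≤K))
                        | ≡ᵇ-sym x b =
          trans (+-cong refl (zeroˡ _)) (trans (+-identityʳ _)
            (trans (sym (⟦∧⟧ (b ≡ᵇ x) _))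
              (reflexive (P.cong ⟦_⟧ (P.sym (∧-assoc (b ≡ᵇ x) (does (filter (_≤? K) u ≟W a)) (does (filter (K <?_) u ≟W (y ∷ c)))))))))
    ... | no b≰K rewrite LP.filter-reject (_≤? K) {b} {u} b≰K | LP.filter-accept (K <?_) {b} {u} (ℕP.≰⇒> b≰K)
                       | ≢⇒≡ᵇ≡false x b (λ e → b≰K (P.subst (_≤ K) e x≤K))
                       | ≡ᵇ-sym y b =
          trans (+-cong (zeroˡ _) refl) (trans (+-identityˡ _)
            (trans (sym (⟦∧⟧ (b ≡ᵇ y) _))
              (reflexive (P.cong ⟦_⟧ (∧-leftComm (b ≡ᵇ y) (does (filter (_≤? K) u ≟W (x ∷ a))) (does (filter (K <?_) u ≟W c)))))))

  Σmasks : (List Bool → Bool) → ℕ → Carrier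
  Σmasks φ n = Σ[ map (λ m → ⟦ φ m ⟧) (allMasks n) ]

  Σmasks-suc : ∀ φ n → Σmasks φ (suc n) ≈ Σmasks (φ ∘ (true ∷_)) n + Σmasks (φ ∘ (false ∷_)) n
  Σmasks-suc φ n = trans (Σ-map++ (λ m → ⟦ φ m ⟧) (map (true ∷_) (allMasks n)) (map (false ∷_) (allMasks n)))
                      (+-cong (reflexive (Σ-map (allMasks n) (true ∷_) (λ m → ⟦ φ m ⟧)))
                              (reflexive (Σ-map (allMasks n) (false ∷_) (λ m → ⟦ φ m ⟧))))

  Σmasks-allFalse : ∀ n φ → (∀ m → T (φ m) → #true m ≡ 0) → ⟦ φ (replicate n false) ⟧ ≈ Σmasks φ n
  Σmasks-allFalse zero φ h = sym (+-identityʳ _)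
  Σmasks-allFalse (suc n) φ h = sym (trans (Σmasks-suc φ n)
    (trans (+-cong (Σ-0 (allMasks n) _ (λ {m} _ → reflexive (P.cong ⟦_⟧ (¬T⇒≡false (ℕP.1+n≢0 ∘ h (true ∷ m)))))) refl)
      (trans (+-identityˡ _) (sym (Σmasks-allFalse n (φ ∘ (false ∷_)) (λ m → h (false ∷ m)))))))

  Σmasks-allTrue : ∀ n φ → (∀ m → T (φ m) → #false m ≡ 0) → ⟦ φ (replicate n true) ⟧ ≈ Σmasks φ n
  Σmasks-allTrue zero φ h = sym (+-identityʳ _)
  Σmasks-allTrue (suc n) φ h = sym (trans (Σmasks-suc φ n)
    (trans (+-cong refl (Σ-0 (allMasks n) _ (λ {m} _ → reflexive (P.cong ⟦_⟧ (¬T⇒≡false (ℕP.1+n≢0 ∘ h (false ∷ m)))))))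
      (trans (+-identityʳ _) (sym (Σmasks-allTrue n (φ ∘ (true ∷_)) (λ m → h (true ∷ m)))))))

  -- The masks of the shuffles of a and c are exactly the masks with |a| letters true and |c| false.
  Σshuffles-mask : ∀ a c (φ : List Bool → Bool) → (∀ m → T (φ m) → #true m ≡ length a × #false m ≡ length c) →
    Σ[ map (λ z → ⟦ φ (mask z) ⟧) (shuffles a c) ] ≈ Σmasks φ (length a ℕ.+ length c)
  Σshuffles-mask [] c φ counts = trans (+-identityʳ _) (trans (reflexive (P.cong (λ m → ⟦ φ m ⟧) (mask-inj₂ c)))
    (Σmasks-allFalse (length c) φ (λ m t → proj₁ (counts m t))))
  Σshuffles-mask (x ∷ a) [] φ counts = trans (+-identityʳ _) (trans (reflexive (P.cong (λ m → ⟦ φ m ⟧) (mask-inj₁ (x ∷ a))))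
    (trans (Σmasks-allTrue (length (x ∷ a)) φ (λ m t → proj₂ (counts m t)))
      (reflexive (P.cong (Σmasks φ) (P.sym (ℕP.+-identityʳ (length (x ∷ a))))))))
  Σshuffles-mask (x ∷ a) (y ∷ c) φ counts = begin
      Σ[ map (λ z → ⟦ φ (mask z) ⟧) (shuffles (x ∷ a) (y ∷ c)) ]
        ≈⟨ Σ-shuffles-∷ _ x a y c ⟩
      Σ[ map (λ z → ⟦ φ (true ∷ mask z) ⟧) (shuffles a (y ∷ c)) ] +
      Σ[ map (λ z → ⟦ φ (false ∷ mask z) ⟧) (shuffles (x ∷ a) c) ]
        ≈⟨ +-cong (Σshuffles-mask a (y ∷ c) (φ ∘ (true ∷_)) (λ m t → let (#t , #f) = counts (true ∷ m) t in ℕP.suc-injective #t , #f))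
                  (trans (Σshuffles-mask (x ∷ a) c (φ ∘ (false ∷_)) (λ m t → let (#t , #f) = counts (false ∷ m) t in #t , ℕP.suc-injective #f))
                         (reflexive (P.cong (Σmasks (φ ∘ (false ∷_))) (P.sym (ℕP.+-suc (length a) (length c)))))) ⟩
      Σmasks (φ ∘ (true ∷_)) (length a ℕ.+ suc (length c)) + Σmasks (φ ∘ (false ∷_)) (length a ℕ.+ suc (length c))
        ≈⟨ sym (Σmasks-suc φ (length a ℕ.+ suc (length c))) ⟩
      Σmasks φ (suc (length a ℕ.+ suc (length c))) ∎

  Σmasks-length : ∀ φ N N′ → (∀ m → T (φ m) → length m ≡ N × length m ≡ N′) → Σmasks φ N ≈ Σmasks φ N′
  Σmasks-length φ N N′ lengths with N ℕP.≟ N′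
  ... | yes P.refl = refl
  ... | no N≢N′ = trans (Σ-0 (allMasks N) _ (λ {m} m∈ → vanish (λ t → P.trans (P.sym (∈-allMasks⇒length N m∈)) (proj₂ (lengths m t)))))
                        (sym (Σ-0 (allMasks N′) _ (λ {m} m∈ → vanish (λ t → P.trans (P.sym (proj₁ (lengths m t))) (∈-allMasks⇒length N′ m∈)))))
    where
    vanish : ∀ {m} → (T (φ m) → N ≡ N′) → ⟦ φ m ⟧ ≈ 0#
    vanish N≡N′ = reflexive (P.cong ⟦_⟧ (¬T⇒≡false (N≢N′ ∘ N≡N′)))


module Coproduct {c ℓ : Level} (Kf : Char0Field c ℓ) where

  open import Data.Nat as ℕ using (ℕ; suc; _≤_; _<_; s≤s; _≡ᵇ_; _≤?_; _<?_)
  import Data.Nat.Properties as ℕP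
  open import Data.Bool using (Bool; true; false; _∧_; T)
  open import Data.Unit using (tt)
  open import Data.List using (List; map; filter; length; upTo)
  open import Data.List.Membership.Propositional using (_∈_)
  open import Data.List.Membership.Propositional.Properties using (∈-upTo⁻; ∈-upTo⁺; ∈-map⁻)
  import Data.List.Relation.Unary.All as All
  import Data.List.Relation.Unary.Unique.Propositional.Properties as Unique
  open import Data.Product using (_,_; proj₁; proj₂)
  open import Relation.Nullary using (¬_; yes; no; does)
  open import Relation.Nullary.Decidable using (dec-false)
  import Relation.Binary.PropositionalEquality as P
  open P using (_≡_)

  open Char0Field Kf
  open Poly Kf
  open import Relation.Binary.Reasoning.Setoid setoid
  open BoolFacts
  open FiniteSums Kf
  open ShuffleSums Kf
  open Shuffles
  open Packing using (pck-idem; packed⇒gapless; gapless⇒packed; pck-shift; ≤-maxW; maxW-filter; maxW-filter-≤; filter->-shift)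
  open OrderIso
  open CompatCheck using (does-Compat?; forestCompat-length; forestCompat)
  open TaggedWords using (erase; mask; #true; #false; length≡#true+#false)
  open Cuts using (cut; admissible; cut-sizes; admissible-length)
  open CutCompat using (forestCompat-erase)

  -- Evaluated at (w₁, w₂), the coproduct of M_u sees only the cut at K = max (pck w₁), which
  -- singles out the shuffles of pck w₁ with pck w₂ shifted by K.
  module _ (w₁ w₂ : Word) where

    K : ℕ
    K = maxW (pck w₁)

    lower upper : Word
    lower = pck w₁
    upper = map (K ℕ.+_) (pck w₂)

    lower≤K : All.All (_≤ K) lower
    lower≤K = All.tabulate (≤-maxW lower)

    K<upper : All.All (K <_) upper
    K<upper = All.tabulate K<
      where
      K< : ∀ {x} → x ∈ upper → K < x
      K< x∈ with ∈-map⁻ (K ℕ.+_) x∈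
      ... | y , y∈ , P.refl = ℕP.m<m+n K (All.lookup (proj₁ (packed⇒gapless (pck w₂) (pck-idem w₂))) y∈)

    erase-shuffle-packed : ∀ {z} → z ∈ shuffles lower upper → pck (erase z) ≡ erase z
    erase-shuffle-packed {z} z∈ =
      gapless⇒packed (erase z)
        (erase-gapless lower (pck w₂) z (packed⇒gapless lower (pck-idem w₁)) (packed⇒gapless (pck w₂) (pck-idem w₂))
          (proj₁ (shuffles-lefts-rights lower upper z∈)) (proj₂ (shuffles-lefts-rights lower upper z∈)))

    module _ (u : Word) (packed : pck u ≡ u) where

      summand : ℕ → Carrier
      summand k = M (filter (_≤? k) u) w₁ * M (pck (filter (k <?_) u)) w₂

      -- For packed u, max (u|≤k) = k, so M_{u|≤k} (w₁) vanishes unless k = K.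
      summand-δ : ∀ {k} → k ∈ upTo (suc (maxW u)) → summand k ≈ ⟦ k ≡ᵇ K ⟧ * summand K
      summand-δ {k} k∈ with k ≡ᵇ K in k≡ᵇK
      ... | true rewrite ℕP.≡ᵇ⇒≡ k K (P.subst T (P.sym k≡ᵇK) tt) = sym (*-identityˡ _)
      ... | false = trans (*-congʳ (reflexive (P.cong ⟦_⟧ (dec-false (lower ≟W filter (_≤? k) u) lower≢))))
                          (trans (zeroˡ _) (sym (zeroˡ _)))
        where
        lower≢ : ¬ lower ≡ filter (_≤? k) u
        lower≢ eq = ≡ᵇ≡false⇒≢ k K k≡ᵇK
                      (P.trans (P.sym (maxW-filter-≤ u packed k (ℕ.s≤s⁻¹ (∈-upTo⁻ k∈)))) (P.cong maxW (P.sym eq)))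

      splits-at-K : (does (lower ≟W filter (_≤? K) u) ∧ does (pck w₂ ≟W pck (filter (K <?_) u))) ≡
                    (does (filter (_≤? K) u ≟W lower) ∧ does (filter (K <?_) u ≟W upper))
      splits-at-K = T-ext to from
        where
        to : T (does (lower ≟W filter (_≤? K) u) ∧ does (pck w₂ ≟W pck (filter (K <?_) u))) →
             T (does (filter (_≤? K) u ≟W lower) ∧ does (filter (K <?_) u ≟W upper))
        to h with T-∧⁻ {does (lower ≟W filter (_≤? K) u)} h
        ... | h₁ , h₂ = T-∧⁺ (≟W-complete (P.sym (≟W-sound {lower} h₁)))
                             (≟W-complete (P.trans (filter->-shift u K (packed⇒gapless u packed))
                                                   (P.cong (map (K ℕ.+_)) (P.sym (≟W-sound {pck w₂} h₂)))))
        from : T (does (filter (_≤? K) u ≟W lower) ∧ does (filter (K <?_) u ≟W upper)) →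
               T (does (lower ≟W filter (_≤? K) u) ∧ does (pck w₂ ≟W pck (filter (K <?_) u)))
        from h with T-∧⁻ {does (filter (_≤? K) u ≟W lower)} h
        ... | h₁ , h₂ = T-∧⁺ (≟W-complete (P.sym (≟W-sound {filter (_≤? K) u} h₁)))
                             (≟W-complete (P.sym (P.trans (P.cong pck (≟W-sound {filter (K <?_) u} h₂))
                                                          (P.trans (pck-shift K (pck w₂)) (pck-idem w₂)))))

      ΔM-at-K : ΔM u w₁ w₂ ≈ ⟦ does (filter (_≤? K) u ≟W lower) ∧ does (filter (K <?_) u ≟W upper) ⟧
      ΔM-at-K with K ℕP.≤? maxW u
      ... | yes K≤max = begin
          ΔM u w₁ w₂                                           ≈⟨ Σ-cong (upTo (suc (maxW u))) summand-δ ⟩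
          Σ[ map (λ k → ⟦ k ≡ᵇ K ⟧ * summand K) (upTo (suc (maxW u))) ]
            ≈⟨ Σ-δ-∈ (upTo (suc (maxW u))) K (λ _ → summand K) (Unique.upTo⁺ _) (∈-upTo⁺ (s≤s K≤max)) ⟩
          summand K                                            ≈⟨ sym (⟦∧⟧ _ _) ⟩
          ⟦ does (lower ≟W filter (_≤? K) u) ∧ does (pck w₂ ≟W pck (filter (K <?_) u)) ⟧
                                                               ≡⟨ P.cong ⟦_⟧ splits-at-K ⟩
          ⟦ does (filter (_≤? K) u ≟W lower) ∧ does (filter (K <?_) u ≟W upper) ⟧ ∎
      ... | no K≰max = begin
          ΔM u w₁ w₂                                           ≈⟨ Σ-cong (upTo (suc (maxW u))) summand-δ ⟩
          Σ[ map (λ k → ⟦ k ≡ᵇ K ⟧ * summand K) (upTo (suc (maxW u))) ]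
            ≈⟨ Σ-δ-∉ (upTo (suc (maxW u))) K (λ _ → summand K) (λ K∈ → K≰max (ℕ.s≤s⁻¹ (∈-upTo⁻ K∈))) ⟩
          0#                                                   ≡⟨ P.cong ⟦_⟧ (P.sym (¬T⇒≡false no-split)) ⟩
          ⟦ does (filter (_≤? K) u ≟W lower) ∧ does (filter (K <?_) u ≟W upper) ⟧ ∎
        where
        no-split : ¬ T (does (filter (_≤? K) u ≟W lower) ∧ does (filter (K <?_) u ≟W upper))
        no-split h = K≰max (P.subst (_≤ maxW u) (P.cong maxW (≟W-sound {filter (_≤? K) u} (proj₁ (T-∧⁻ {does (filter (_≤? K) u ≟W lower)} h))))
                                    (maxW-filter (_≤? K) u))

      ΔM-shuffles : ΔM u w₁ w₂ ≈ Σ[ map (λ z → M u (erase z)) (shuffles lower upper) ]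
      ΔM-shuffles = begin
        ΔM u w₁ w₂                                                 ≈⟨ ΔM-at-K ⟩
        ⟦ does (filter (_≤? K) u ≟W lower) ∧ does (filter (K <?_) u ≟W upper) ⟧
                                                                   ≈⟨ sym (Σ-shuffles-≟ K lower upper u lower≤K K<upper) ⟩
        Σ[ map (λ z → ⟦ does (erase z ≟W u) ⟧) (shuffles lower upper) ]
          ≈⟨ Σ-cong (shuffles lower upper) (λ z∈ → reflexive (P.cong (λ w → ⟦ does (w ≟W u) ⟧) (P.sym (erase-shuffle-packed z∈)))) ⟩
        Σ[ map (λ z → M u (erase z)) (shuffles lower upper) ] ∎

    module _ {S : Signature} (f : Forest S) where

      trunk pruned : List Bool → Forest S
      trunk m = proj₁ (cut f m)
      pruned m = proj₂ (cut f m)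

      cutCompat : List Bool → Bool
      cutCompat m = admissible f m ∧ (forestCompat (trunk m) lower ∧ forestCompat (pruned m) upper)

      cutCompat-counts : ∀ m → T (cutCompat m) → #true m ≡ length lower × #false m ≡ length upper
      cutCompat-counts m h with T-∧⁻ {admissible f m} h
      ... | adm , h₂₃ with T-∧⁻ {forestCompat (trunk m) lower} h₂₃
      ... | trunk-compat , pruned-compat =
        P.trans (P.sym (proj₁ (cut-sizes f m adm))) (P.sym (forestCompat-length (trunk m) lower trunk-compat)) ,
        P.trans (P.sym (proj₂ (cut-sizes f m adm))) (P.sym (forestCompat-length (pruned m) upper pruned-compat))

      forestCompat-lower : ∀ m → ⟦ forestCompat (trunk m) lower ⟧ ≡ rE (trunk m) w₁
      forestCompat-lower m = P.cong ⟦_⟧ (P.trans (P.sym (does-Compat? (trunk m) lower))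
                               (P.sym (does-Compat?-OrderIso (trunk m) {w₁} {lower} (OrderIso-pck w₁))))

      forestCompat-upper : ∀ m → ⟦ forestCompat (pruned m) upper ⟧ ≡ rE (pruned m) w₂
      forestCompat-upper m = P.cong ⟦_⟧ (P.trans (P.sym (does-Compat? (pruned m) upper))
        (P.sym (does-Compat?-OrderIso (pruned m) {w₂} {upper}
                  (OrderIso-trans {w₂} {pck w₂} {upper} (OrderIso-pck w₂) (OrderIso-shift K (pck w₂))))))

      Σshuffles-rE : Σ[ map (λ z → rE f (erase z)) (shuffles lower upper) ] ≈
                     Σ[ map (λ m → ⟦ admissible f m ⟧ * (rE (trunk m) w₁ * rE (pruned m) w₂)) (allMasks (dg f)) ]
      Σshuffles-rE = begin
        Σ[ map (λ z → rE f (erase z)) (shuffles lower upper) ]    ≈⟨ Σ-cong (shuffles lower upper) rE-shuffle ⟩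
        Σ[ map (λ z → ⟦ cutCompat (mask z) ⟧) (shuffles lower upper) ]
                                                                  ≈⟨ Σshuffles-mask lower upper cutCompat cutCompat-counts ⟩
        Σmasks cutCompat (length lower ℕ.+ length upper)           ≈⟨ Σmasks-length cutCompat _ _ lengths ⟩
        Σmasks cutCompat (dg f)                                    ≈⟨ Σ-cong′ (allMasks (dg f)) factor ⟩
        Σ[ map (λ m → ⟦ admissible f m ⟧ * (rE (trunk m) w₁ * rE (pruned m) w₂)) (allMasks (dg f)) ] ∎
        where
        rE-shuffle : ∀ {z} → z ∈ shuffles lower upper → rE f (erase z) ≈ ⟦ cutCompat (mask z) ⟧
        rE-shuffle {z} z∈ with shuffles-lefts-rights lower upper z∈
        ... | lefts≡ , rights≡ = reflexive (P.cong ⟦_⟧ (P.trans (does-Compat? f (erase z))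
          (P.trans (forestCompat-erase f z (shuffles-LeftsBelowRights K lower upper lower≤K K<upper z∈))
            (P.cong₂ (λ l r → admissible f (mask z) ∧ (forestCompat (trunk (mask z)) l ∧ forestCompat (pruned (mask z)) r)) lefts≡ rights≡))))
        lengths : ∀ m → T (cutCompat m) → length m ≡ length lower ℕ.+ length upper × length m ≡ dg f
        lengths m h = P.trans (length≡#true+#false m) (P.cong₂ ℕ._+_ (proj₁ (cutCompat-counts m h)) (proj₂ (cutCompat-counts m h))) ,
                      admissible-length f m (proj₁ (T-∧⁻ {admissible f m} h))
        factor : ∀ m → ⟦ cutCompat m ⟧ ≈ ⟦ admissible f m ⟧ * (rE (trunk m) w₁ * rE (pruned m) w₂)
        factor m = trans (⟦∧⟧ (admissible f m) _) (*-congˡ (trans (⟦∧⟧ (forestCompat (trunk m) lower) _)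
                     (*-cong (reflexive (forestCompat-lower m)) (reflexive (forestCompat-upper m)))))


module Product {c ℓ : Level} (Kf : Char0Field c ℓ) where

  open import Data.Nat as ℕ using (ℕ; suc; _≤_; s≤s; _≡ᵇ_)
  import Data.Nat.Properties as ℕP
  open import Data.Bool using (true; false; _∧_; T)
  open import Data.Unit using (tt)
  open import Data.List using (List; _++_; map; length; upTo; take; drop)
  open import Data.List.Membership.Propositional using (_∈_)
  open import Data.List.Membership.Propositional.Properties using (∈-upTo⁻; ∈-upTo⁺)
  import Data.List.Relation.Unary.Unique.Propositional.Properties as Unique
  open import Relation.Nullary using (¬_; yes; no)
  import Relation.Binary.PropositionalEquality as P
  open P using (_≡_)

  open Char0Field Kf
  open Poly Kf
  open import Relation.Binary.Reasoning.Setoid setoid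
  open BoolFacts
  open FiniteSums Kf
  open TakeDrop using (length-take≤)
  open CompatCheck using (does-Compat?; forestCompat-length; forestCompat; forestCompat-++; dg-++)

  module _ {S : Signature} (f g : Forest S) (w : Word) where

    prefixes : List ℕ
    prefixes = upTo (suc (length w))

    rE-split-δ : ∀ {i} → i ∈ prefixes →
                 rE f (take i w) * rE g (drop i w) ≈ ⟦ i ≡ᵇ dg f ⟧ * (rE f (take (dg f) w) * rE g (drop (dg f) w))
    rE-split-δ {i} i∈ with i ≡ᵇ dg f in i≡ᵇdg
    ... | true rewrite ℕP.≡ᵇ⇒≡ i (dg f) (P.subst T (P.sym i≡ᵇdg) tt) = sym (*-identityˡ _)
    ... | false = trans (*-congʳ (reflexive (P.cong ⟦_⟧ (P.trans (does-Compat? f (take i w)) (¬T⇒≡false wrong-length)))))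
                        (trans (zeroˡ _) (sym (zeroˡ _)))
      where
      wrong-length : ¬ T (forestCompat f (take i w))
      wrong-length h = ≡ᵇ≡false⇒≢ i (dg f) i≡ᵇdg
        (P.trans (P.sym (length-take≤ i w (ℕ.s≤s⁻¹ (∈-upTo⁻ i∈)))) (forestCompat-length f (take i w) h))

    Σdeconcat-rE : Σ[ map (λ i → rE f (take i w) * rE g (drop i w)) prefixes ] ≈ rE (f ++ g) w
    Σdeconcat-rE with dg f ℕP.≤? length w
    ... | yes dg≤ = begin
        Σ[ map (λ i → rE f (take i w) * rE g (drop i w)) prefixes ]
          ≈⟨ Σ-cong prefixes rE-split-δ ⟩
        Σ[ map (λ i → ⟦ i ≡ᵇ dg f ⟧ * (rE f (take (dg f) w) * rE g (drop (dg f) w))) prefixes ]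
          ≈⟨ Σ-δ-∈ prefixes (dg f) (λ _ → rE f (take (dg f) w) * rE g (drop (dg f) w)) (Unique.upTo⁺ _) (∈-upTo⁺ (s≤s dg≤)) ⟩
        rE f (take (dg f) w) * rE g (drop (dg f) w)
          ≡⟨ P.cong₂ (λ x y → ⟦ x ⟧ * ⟦ y ⟧) (does-Compat? f (take (dg f) w)) (does-Compat? g (drop (dg f) w)) ⟩
        ⟦ forestCompat f (take (dg f) w) ⟧ * ⟦ forestCompat g (drop (dg f) w) ⟧
          ≈⟨ sym (⟦∧⟧ _ _) ⟩
        ⟦ forestCompat f (take (dg f) w) ∧ forestCompat g (drop (dg f) w) ⟧
          ≡⟨ P.cong ⟦_⟧ (P.trans (P.sym (forestCompat-++ f g w)) (P.sym (does-Compat? (f ++ g) w))) ⟩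
        rE (f ++ g) w ∎
    ... | no dg≰ = begin
        Σ[ map (λ i → rE f (take i w) * rE g (drop i w)) prefixes ]
          ≈⟨ Σ-0 prefixes _ (λ i∈ → trans (rE-split-δ i∈) (trans (*-congʳ (reflexive (P.cong ⟦_⟧ (dg≢ i∈)))) (zeroˡ _))) ⟩
        0#
          ≡⟨ P.cong ⟦_⟧ (P.sym (P.trans (does-Compat? (f ++ g) w) (¬T⇒≡false too-short))) ⟩
        rE (f ++ g) w ∎
      where
      dg≢ : ∀ {i} → i ∈ prefixes → (i ≡ᵇ dg f) ≡ false
      dg≢ {i} i∈ = ≢⇒≡ᵇ≡false i (dg f) (λ { P.refl → dg≰ (ℕ.s≤s⁻¹ (∈-upTo⁻ i∈)) })
      too-short : ¬ T (forestCompat (f ++ g) w)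
      too-short h = dg≰ (P.subst (dg f ≤_) (P.sym (P.trans (forestCompat-length (f ++ g) w h) (dg-++ f g)))
                                 (ℕP.m≤m+n (dg f) (dg g)))

module HopfSubalgebra {c ℓ : Level} (Kf : Char0Field c ℓ) (S : Signature) where

  open import Data.List using (List; []; _∷_; _++_; map; length; upTo; concatMap)
  open import Data.List.Membership.Propositional.Properties using (∈-filter⁻)
  open import Data.List.Relation.Unary.All using (All; [])
  import Data.List.Relation.Unary.All as All
  import Data.List.Relation.Unary.All.Properties as AllP
  open import Data.Nat using (suc)
  open import Data.Product using (_×_; _,_; proj₁; proj₂)
  import Relation.Binary.PropositionalEquality as P
  open import Algebra.Properties.CommutativeSemigroup using (interchange)

  open Char0Field Kf
  open Poly Kf
  open import Relation.Binary.Reasoning.Setoid setoid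
  open FiniteSums Kf
  open Expansion Kf using (expansion)
  open Product Kf using (Σdeconcat-rE)
  open Coproduct Kf using (lower; upper; ΔM-shuffles; Σshuffles-rE)
  open Shuffles using (shuffles; allMasks)
  open TaggedWords using (erase)
  open Cuts using (cut; admissible)

  rE∈image : ∀ (f : Forest S) → InImage S (rE f)
  rE∈image f = ((1# , f) ∷ []) , λ w → sym (trans (+-identityʳ _) (*-identityˡ _))

  mExpansion : List (Carrier × Forest S) → List (Carrier × Word)
  mExpansion cs = concatMap (λ (c , f) → map (λ u → (c * [ Compat? f u ]? , u)) (packedWords (dg f))) cs

  mExpansion-packed : ∀ cs → All (λ cu → IsPacked (proj₂ cu)) (mExpansion cs)
  mExpansion-packed [] = []
  mExpansion-packed ((c , f) ∷ cs) = AllP.++⁺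
    (AllP.map⁺ (All.tabulate (λ u∈ → proj₂ (∈-filter⁻ (λ u → pck u ≟W u) {xs = wordsOver (dg f) (dg f)} u∈))))
    (mExpansion-packed cs)

  rLin≐evalM : ∀ cs → rLin cs ≐ evalM (mExpansion cs)
  rLin≐evalM cs w = sym (begin
      evalM (mExpansion cs) w
        ≈⟨ Σ-concatMap cs _ _ ⟩
      Σ[ map (λ (c , f) → Σ[ map (λ cu → proj₁ cu * M (proj₂ cu) w) (map (λ u → (c * [ Compat? f u ]? , u)) (packedWords (dg f))) ]) cs ]
        ≈⟨ Σ-cong′ cs (λ (c , f) → trans (reflexive (Σ-map (packedWords (dg f)) _ _))
              (trans (Σ-cong′ (packedWords (dg f)) (λ u → *-assoc _ _ _))
                (trans (sym (Σ-*ˡ c (packedWords (dg f)) _)) (*-congˡ (sym (expansion f w)))))) ⟩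
      rLin cs w ∎)

  1P≐rLin : 1P ≐ rLin {S = S} ((1# , []) ∷ [])
  1P≐rLin [] = sym (trans (+-identityʳ _) (*-identityˡ _))
  1P≐rLin (x ∷ w) = sym (trans (+-identityʳ _) (zeroʳ _))

  productTerms : List (Carrier × Forest S) → List (Carrier × Forest S) → List (Carrier × Forest S)
  productTerms cs ds = concatMap (λ (c , f) → map (λ (d , g) → (c * d , f ++ g)) ds) cs

  rLin-* : ∀ cs ds → (rLin cs *P rLin ds) ≐ rLin (productTerms cs ds)
  rLin-* cs ds w = begin
      Σ[ map (λ i → rLin cs (take i w) * rLin ds (drop i w)) I ]
        ≈⟨ Σ-cong′ I (λ i → trans (Σ-*ʳ _ cs _) (Σ-cong′ cs (λ _ → Σ-*ˡ _ ds _))) ⟩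
      Σ[ map (λ i → Σ[ map (λ (c , f) → Σ[ map (λ (d , g) → (c * rE f (take i w)) * (d * rE g (drop i w))) ds ]) cs ]) I ]
        ≈⟨ trans (Σ-swap I cs _) (Σ-cong′ cs (λ _ → Σ-swap I ds _)) ⟩
      Σ[ map (λ (c , f) → Σ[ map (λ (d , g) → Σ[ map (λ i → (c * rE f (take i w)) * (d * rE g (drop i w))) I ]) ds ]) cs ]
        ≈⟨ Σ-cong′ cs (λ (c , f) → Σ-cong′ ds (λ (d , g) →
             trans (Σ-cong′ I (λ i → interchange *-commutativeSemigroup _ _ _ _))
                   (trans (sym (Σ-*ˡ _ I _)) (*-congˡ (Σdeconcat-rE f g w))))) ⟩
      Σ[ map (λ (c , f) → Σ[ map (λ (d , g) → (c * d) * rE (f ++ g) w) ds ]) cs ]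
        ≈⟨ trans (Σ-cong′ cs (λ _ → reflexive (P.sym (Σ-map ds _ _)))) (sym (Σ-concatMap cs _ _)) ⟩
      rLin (productTerms cs ds) w ∎
    where
    open import Data.List using (take; drop)
    I = upTo (suc (length w))

  coproductTerms : List (Carrier × Forest S) → List (Carrier × Pol × Pol)
  coproductTerms cs = concatMap (λ (c , f) →
    map (λ m → (c * ⟦ admissible f m ⟧ , rE (proj₁ (cut f m)) , rE (proj₂ (cut f m)))) (allMasks (dg f))) cs

  coproductTerms∈image : ∀ cs → All (λ x → InImage S (proj₁ (proj₂ x)) × InImage S (proj₂ (proj₂ x))) (coproductTerms cs)
  coproductTerms∈image [] = []
  coproductTerms∈image ((c , f) ∷ cs) =
    AllP.++⁺ (AllP.map⁺ (All.universal (λ m → rE∈image (proj₁ (cut f m)) , rE∈image (proj₂ (cut f m))) (allMasks (dg f))))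
             (coproductTerms∈image cs)

  -- By ΔM-shuffles, ΔP (w₁, w₂) is a sum of values of P, so it does not depend on the
  -- M-expansion of P and can be computed from its expansion in the rE f instead.
  Δ-closed : ∀ P (L : List (Carrier × Word)) → InImage S P → All (λ cu → IsPacked (proj₂ cu)) L → P ≐ evalM L →
             InTensor (InImage S) (ΔL L)
  Δ-closed P L (cs , P≐rLin) packed P≐evalM = coproductTerms cs , coproductTerms∈image cs , ΔL≈
    where
    ΔL≈ : ∀ w₁ w₂ → ΔL L w₁ w₂ ≈ Σ[ map (λ x → proj₁ x * (proj₁ (proj₂ x) w₁ * proj₂ (proj₂ x) w₂)) (coproductTerms cs) ]
    ΔL≈ w₁ w₂ = begin
        Σ[ map (λ cu → proj₁ cu * ΔM (proj₂ cu) w₁ w₂) L ]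
          ≈⟨ Σ-cong L (λ cu∈ → *-congˡ (ΔM-shuffles w₁ w₂ _ (All.lookup packed cu∈))) ⟩
        Σ[ map (λ cu → proj₁ cu * Σ[ map (λ z → M (proj₂ cu) (erase z)) Zs ]) L ]
          ≈⟨ trans (Σ-cong′ L (λ cu → Σ-*ˡ (proj₁ cu) Zs _)) (Σ-swap L Zs _) ⟩
        Σ[ map (λ z → evalM L (erase z)) Zs ]
          ≈⟨ Σ-cong′ Zs (λ z → trans (sym (P≐evalM (erase z))) (P≐rLin (erase z))) ⟩
        Σ[ map (λ z → rLin cs (erase z)) Zs ]
          ≈⟨ Σ-swap Zs cs _ ⟩
        Σ[ map (λ (c , f) → Σ[ map (λ z → c * rE f (erase z)) Zs ]) cs ]
          ≈⟨ Σ-cong′ cs (λ (c , f) → trans (sym (Σ-*ˡ c Zs _)) (trans (*-congˡ (Σshuffles-rE w₁ w₂ f))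
               (trans (Σ-*ˡ c (allMasks (dg f)) _)
                 (trans (Σ-cong′ (allMasks (dg f)) (λ m → sym (*-assoc _ _ _)))
                   (reflexive (P.sym (Σ-map (allMasks (dg f)) _ _))))))) ⟩
        Σ[ map (λ (c , f) → Σ[ map (λ x → proj₁ x * (proj₁ (proj₂ x) w₁ * proj₂ (proj₂ x) w₂))
              (map (λ m → (c * ⟦ admissible f m ⟧ , rE (proj₁ (cut f m)) , rE (proj₂ (cut f m)))) (allMasks (dg f))) ]) cs ]
          ≈⟨ sym (Σ-concatMap cs _ _) ⟩
        Σ[ map (λ x → proj₁ x * (proj₁ (proj₂ x) w₁ * proj₂ (proj₂ x) w₂)) (coproductTerms cs) ] ∎
      where
      Zs = shuffles (lower w₁ w₂) (upper w₁ w₂)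

  isHopfSubalgebra : IsHopfSubalgebraOfWQSym (InImage S)
  isHopfSubalgebra = record
    { sub = λ P (cs , P≐) → mExpansion cs , mExpansion-packed cs , λ w → trans (P≐ w) (rLin≐evalM cs w)
    ; resp = λ P Q P≐Q (cs , P≐) → cs , λ w → trans (sym (P≐Q w)) (P≐ w)
    ; zero∈ = [] , λ w → refl
    ; +-closed = λ P Q (cs , P≐) (ds , Q≐) → cs ++ ds , λ w → trans (+-cong (P≐ w) (Q≐ w)) (sym (Σ-map++ _ cs ds))
    ; ·-closed = λ a P (cs , P≐) → map (λ (c , f) → (a * c , f)) cs ,
        λ w → trans (*-congˡ (P≐ w)) (trans (Σ-*ˡ a cs _)
                (trans (Σ-cong′ cs (λ _ → sym (*-assoc _ _ _))) (reflexive (P.sym (Σ-map cs _ _)))))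
    ; one∈ = ((1# , []) ∷ []) , 1P≐rLin
    ; *-closed = λ P Q (cs , P≐) (ds , Q≐) → productTerms cs ds ,
        λ w → trans (Σ-cong′ (upTo (suc (length w))) (λ i → *-cong (P≐ _) (Q≐ _))) (rLin-* cs ds w)
    ; Δ-closed = Δ-closed
    }


mainTheorem5 : ∀ {c ℓ : Level} (K : Char0Field c ℓ) (S : Signature) →
    let open Char0Field K
        open Poly K
    in IsHopfSubalgebraOfWQSym (InImage S)
       × (∀ (f : Forest S) (w : Word) →
            rE f w ≈ Σ[ map (λ u → [ Compat? f u ]? * M u w) (packedWords (dg f)) ])
mainTheorem5 K S = HopfSubalgebra.isHopfSubalgebra K S , Expansion.expansion K
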